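{- Let $p$ be a prime and let $n,m\ge 1$ be integers. There exist infinitely many pairwise non-isomorphic finite graphs $G$ such that $\mathrm{MH}_{3,2n+3}(G)$ contains a subgroup isomorphic to $\mathbb{Z}_{p^m}$.
   Context: All graphs are finite, undirected, with no loops and no multiple edges. For a graph $G$, $d(x,y)$ denotes the shortest-path distance (edges have length $1$; $\infty$ if no path). A $k$-path is a tuple $(x_0,\dots,x_k)$ of vertices with $x_i\neq x_{i+1}$ and $d(x_i,x_{i+1})<\infty$; its length is $\sum_i d(x_i,x_{i+1})$. $\mathrm{MC}_{k,\ell}(G)$ is the free abelian group on $k$-paths of length $\ell$, with differential $\partial=\sum_{i=1}^{k-1}(-1)^i\partial_i$, where $\partial_i$ deletes $x_i$ if the resulting tuple is a $(k-1)$-path of the same length $\ell$ and is $0$ otherwise; $\mathrm{MH}_{k,\ell}(G)=H_k(\mathrm{MC}_{*,\ell}(G))$. -}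

module Defs where

open import Data.Nat as ℕ using (ℕ; zero; suc; _≡ᵇ_)
open import Data.Bool using (Bool; true; false; _∨_; _∧_; if_then_else_)
open import Data.Fin using (Fin; toℕ; inject₁) renaming (zero to fzero; suc to fsuc)
import Data.Fin as F
open import Data.Vec using (Vec; []; _∷_; insertAt; allFin; foldr)
import Data.Vec as V
open import Data.Maybe using (Maybe; just; nothing)
open import Data.Integer as ℤ using (ℤ; 0ℤ; 1ℤ; -1ℤ; +_)
open import Data.Integer.Divisibility using () renaming (_∣_ to _∣ℤ_)
open import Data.Product using (Σ; _×_; _,_; proj₁; proj₂; ∃)
open import Relation.Nullary using (¬_; does)
open import Relation.Binary.PropositionalEquality using (_≡_; _≢_)
open import Function.Bundles using (_↔_; Inverse)

record Graph : Set where
  field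
    size   : ℕ
    adj    : Fin size → Fin size → Bool
    adj-sym    : ∀ x y → adj x y ≡ adj y x
    adj-irrefl : ∀ x → adj x x ≡ false
open Graph public

Vx : Graph → Set
Vx G = Fin (size G)

_≅G_ : Graph → Graph → Set
G ≅G H = Σ (Vx G ↔ Vx H) λ φ →
  ∀ x y → adj H (Inverse.to φ x) (Inverse.to φ y) ≡ adj G x y

_==_ : ∀ {n} → Fin n → Fin n → Bool
x == y = does (x F.≟ y)

anyV : ∀ {n} → (Fin n → Bool) → Bool
anyV {n} f = foldr _ (λ a b → f a ∨ b) false (allFin n)

sumV : ∀ {n} → (Fin n → ℤ) → ℤ
sumV {n} f = foldr _ (λ a b → f a ℤ.+ b) 0ℤ (allFin n)

-- reach G t x y = true  iff  there is a walk of length ≤ t from x to y,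
-- i.e. d(x,y) ≤ t.
reach : (G : Graph) → ℕ → Vx G → Vx G → Bool
reach G zero x y = x == y
reach G (suc t) x y = reach G t x y ∨ anyV (λ z → reach G t x z ∧ adj G z y)

distSearch : (G : Graph) → ℕ → ℕ → Vx G → Vx G → Maybe ℕ
distSearch G zero t x y = nothing
distSearch G (suc fuel) t x y =
  if reach G t x y then just t else distSearch G fuel (suc t) x y

-- shortest-path distance; nothing = ∞  (distances in a graph with
-- |V| vertices are < |V|, so fuel |V|+1 suffices)
dist : (G : Graph) → Vx G → Vx G → Maybe ℕ
dist G x y = distSearch G (suc (size G)) 0 x y

pathLen : (G : Graph) → ∀ {k} → Vec (Vx G) k → Maybe ℕ
pathLen G [] = just 0
pathLen G (x ∷ []) = just 0
pathLen G (x ∷ y ∷ r) with x == y | dist G x y | pathLen G (y ∷ r)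
... | true  | _      | _      = nothing
... | false | just d | just l = just (d ℕ.+ l)
... | false | _      | _      = nothing

isPath : (G : Graph) → ∀ {k} → ℕ → Vec (Vx G) (suc k) → Bool
isPath G ℓ v with pathLen G v
... | just l  = l ≡ᵇ ℓ
... | nothing = false

-- Chains: an element of MC_{k,ℓ}(G), the free abelian group on k-paths of
-- length ℓ, represented by its coefficient function on (k+1)-tuples,
-- vanishing off k-paths of length ℓ (finite support is automatic).
Coeff : Graph → ℕ → Set
Coeff G k = Vec (Vx G) (suc k) → ℤ

MC : Graph → ℕ → ℕ → Set
MC G k ℓ = Σ (Coeff G k) λ c → ∀ x → isPath G ℓ x ≡ false → c x ≡ 0ℤ

sgn : ℕ → ℤ
sgn zero = 1ℤ
sgn (suc i) = ℤ.- sgn i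

-- The differential ∂ = Σ_{i=1}^{k-1} (-1)^i ∂_i : MC_{k,ℓ} → MC_{k-1,ℓ},
-- here with k = suc (suc j).  The coefficient of a (j+1)-path y is
-- Σ_i (-1)^i Σ_{x : ∂_i x = y} c(x) if y is a path of length ℓ and 0
-- otherwise; the x with ∂_i x = y are the insertions of a vertex v at
-- position i (i = 1,…,j+1 interior positions of x).
∂ : (G : Graph) → ∀ {j} → ℕ → Coeff G (suc j) → Coeff G j
∂ G {j} ℓ c y =
  if isPath G ℓ y
  then sumV {j} (λ i → sgn (suc (toℕ i)) ℤ.*
          sumV {size G} (λ v → c (insertAt y (fsuc (inject₁ i)) v)))
  else 0ℤ

Cycle3 : Graph → ℕ → Set
Cycle3 G ℓ = Σ (MC G 3 ℓ) λ c → ∀ y → ∂ G ℓ (proj₁ c) y ≡ 0ℤ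

HomologousC : (G : Graph) (ℓ : ℕ) → Coeff G 3 → Coeff G 3 → Set
HomologousC G ℓ c d = Σ (MC G 4 ℓ) λ e → ∀ x → c x ℤ.- d x ≡ ∂ G ℓ (proj₁ e) x

Homologous3 : (G : Graph) (ℓ : ℕ) → Cycle3 G ℓ → Cycle3 G ℓ → Set
Homologous3 G ℓ a b = HomologousC G ℓ (proj₁ (proj₁ a)) (proj₁ (proj₁ b))

_+C_ : ∀ {G ℓ} → Cycle3 G ℓ → Cycle3 G ℓ → Coeff G 3
(a +C b) x = proj₁ (proj₁ a) x ℤ.+ proj₁ (proj₁ b) x

-- MH_{3,ℓ}(G) contains a subgroup isomorphic to ℤ/qℤ: an injective group
-- homomorphism ℤ/qℤ → MH_{3,ℓ}(G), with ℤ/qℤ given as ℤ modulo q and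
-- MH as 3-cycles modulo homology (well-defined, additive, injective).
HasCyclicSubgroup3 : (G : Graph) (ℓ q : ℕ) → Set
HasCyclicSubgroup3 G ℓ q = Σ (ℤ → Cycle3 G ℓ) λ f →
    (∀ a b → (+ q) ∣ℤ (a ℤ.- b) → Homologous3 G ℓ (f a) (f b))
  × (∀ a b → HomologousC G ℓ (proj₁ (proj₁ (f (a ℤ.+ b)))) (f a +C f b))
  × (∀ a b → Homologous3 G ℓ (f a) (f b) → (+ q) ∣ℤ (a ℤ.- b))

-- For q ≥ 1, s ≥ 1 and m ≥ 2 with m ≡ 1 (mod q), consider the Hasse diagram of a ranked poset with
-- bottom ⊥ and top ⊤ of rank ℓ = 3 + s.  Its cells r = (k , i) ∈ ℤ/q × ℤ/m carry elements b r < g r and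
-- g r also covers b (r + 1), where r + 1 is the lexicographic successor, so that the b's and g's form a
-- single zigzag cycle; each i carries a i > b (k , i) for all k and a chain e i of length s above g (k , i),
-- a i and a (i + 1); one more chain c of length s lies above all g's.  Since distances in a Hasse diagram
-- are bounded below by rank differences, a path of length ℓ from ⊥ to ⊤ is a saturated chain of the
-- poset, and deleting an inner vertex keeps it a path of length ℓ.
--
-- The 3-chain z = Σᵢ (⊥, a i, e i, ⊤) − (⊥, a (i + 1), e i, ⊤) is a cycle, and an explicit 4-chain W
-- summed over all cells has ∂W = q·z, because the remaining terms telescope along the cycle of cells.
-- Conversely Φ(c) = Σ φ(x₁, x₂) c(⊥, x₁, x₂, ⊤) is divisible by q on every boundary, since φ satisfies
-- φ(v, w) − φ(u, w) + φ(u, v) ≡ 0 (mod q) along chains u < v < w; here m ≡ 1 (mod q) is what makes the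
-- values assigned to the cells consistent around the cycle.  As Φ(z) = m ≡ 1, a ↦ a·z embeds ℤ/q into
-- MH_{3,ℓ}.  Taking q = pᵉ (e the exponent in the statement), s = 2n and m = 1 + q(t + 1) for t ∈ ℕ
-- gives graphs with pairwise different numbers of vertices.

module Submission where

open import Data.Nat as ℕ using (ℕ; zero; suc; _≤_; _<_; z≤n; s≤s)
import Data.Nat.Properties as ℕP
import Data.Nat.Divisibility as ℕ∣
import Data.Nat.Tactic.RingSolver as ℕ-Solver
open import Data.Nat.Primality using (Prime; prime⇒nonZero)
open import Data.Fin as F
  using (Fin; toℕ; fromℕ; inject₁; _↑ˡ_; _↑ʳ_; splitAt; combine; remQuot) renaming (zero to fzero; suc to fsuc)
import Data.Fin.Properties as FP
open import Data.Fin.Induction using (>-weakInduction)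
open import Data.Fin.Permutation using (↔⇒≡)
open import Data.Vec as V using (Vec; []; _∷_; foldr; insertAt; removeAt; initLast; _∷ʳ_)
import Data.Vec.Properties as VP
open import Data.List using (List; []; _∷_)
open import Data.List.Relation.Unary.All using (All; []; _∷_)
open import Data.Bool using (Bool; true; false; if_then_else_; _∧_; _∨_; T)
open import Data.Bool.Properties using (∨-comm)
open import Data.Maybe using (just)
open import Data.Maybe.Properties using (just-injective)
open import Data.Product using (Σ; ∃-syntax; _×_; _,_; proj₁; proj₂; uncurry)
open import Data.Sum using (_⊎_; inj₁; inj₂; [_,_]′)
open import Data.Empty using (⊥-elim)
open import Data.Integer using (ℤ; 0ℤ; 1ℤ; -1ℤ; +_)
import Data.Integer.Properties as ℤP
import Data.Integer.Divisibility as ℤ∣ᵤ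
open import Data.Integer.Divisibility.Signed
  using (_∣_; divides; ∣ᵤ⇒∣; ∣⇒∣ᵤ; ∣-refl; ∣m∣n⇒∣m+n; ∣m⇒∣-m; ∣n⇒∣m*n; ∣m+n∣n⇒∣m)
open import Data.Integer.Tactic.RingSolver using (solve-∀)
open import Algebra.Properties.Semiring.Sum ℤP.+-*-semiring
  using (sum; sum-syntax; sum-cong-≗; ∑-distrib-+; ∑-comm; *-distribˡ-sum; sum-init-last; sum-replicate-zero)
open import Relation.Nullary using (¬_; does; yes)
open import Relation.Nullary.Decidable using (dec-true; dec-false)
open import Relation.Binary.PropositionalEquality
open import Function using (_∘_)
open import Defs

private
  variable
    n a b : ℕ

∧≡true⁻ : ∀ {x y} → x ∧ y ≡ true → x ≡ true × y ≡ true
∧≡true⁻ {true} y≡true = refl , y≡true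

∨≡true⁻ : ∀ {x y} → x ∨ y ≡ true → x ≡ true ⊎ y ≡ true
∨≡true⁻ {true} _ = inj₁ refl
∨≡true⁻ {false} y≡true = inj₂ y≡true

≡ᵇ⇒≡ : ∀ {m n} → (m ℕ.≡ᵇ n) ≡ true → m ≡ n
≡ᵇ⇒≡ {m} {n} eq = ℕP.≡ᵇ⇒≡ m n (subst T (sym eq) _)

≡ᵇ-refl : ∀ n → (n ℕ.≡ᵇ n) ≡ true
≡ᵇ-refl zero = refl
≡ᵇ-refl (suc n) = ≡ᵇ-refl n

==-refl : (i : Fin n) → (i == i) ≡ true
==-refl i = dec-true (i F.≟ i) refl

==-≢ : {i j : Fin n} → i ≢ j → (i == j) ≡ false
==-≢ {i = i} {j} = dec-false (i F.≟ j)

==⇒≡ : {i j : Fin n} → (i == j) ≡ true → i ≡ j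
==⇒≡ {i = i} {j} eq with i F.≟ j
... | yes i≡j = i≡j

data LastView : Fin (suc n) → Set where
  last  : LastView (fromℕ n)
  inner : (j : Fin n) → LastView (inject₁ j)

lastView : (i : Fin (suc n)) → LastView i
lastView {zero} fzero = last
lastView {suc n} fzero = inner fzero
lastView {suc n} (fsuc i) with lastView i
... | last = last
... | inner j = inner (fsuc j)

sucMod : Fin (suc n) → Fin (suc n)
sucMod {zero} fzero = fzero
sucMod {suc n} fzero = fsuc fzero
sucMod {suc n} (fsuc i) = wrap (sucMod i)
  where
  wrap : Fin (suc n) → Fin (suc (suc n))
  wrap fzero = fzero
  wrap (fsuc j) = fsuc (fsuc j)

sucMod-inject₁ : (i : Fin n) → sucMod (inject₁ i) ≡ fsuc i
sucMod-inject₁ {suc n} fzero = refl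
sucMod-inject₁ {suc n} (fsuc i) rewrite sucMod-inject₁ i = refl

sucMod-fromℕ : ∀ n → sucMod (fromℕ n) ≡ fzero
sucMod-fromℕ zero = refl
sucMod-fromℕ (suc n) rewrite sucMod-fromℕ n = refl

sucMod-≢ : (i : Fin (suc (suc n))) → sucMod i ≢ i
sucMod-≢ i with lastView i
... | last = λ eq → FP.0≢1+n (trans (sym (sucMod-fromℕ _)) eq)
... | inner j = λ eq → ℕP.1+n≢n (trans (cong toℕ (trans (sym (sucMod-inject₁ j)) eq)) (FP.toℕ-inject₁ j))

sucLex : Fin (suc a) × Fin (suc b) → Fin (suc a) × Fin (suc b)
sucLex {b = b} (k , i) = (if i == fromℕ b then sucMod k else k) , sucMod i

innerPos : ∀ {j} → Fin j → Fin (suc (suc j))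
innerPos i = fsuc (inject₁ i)

module FiniteSums where

  open import Data.Integer using (-_; _+_; _-_; _*_)

  foldr-tabulate : {A : Set} (h : Fin n → A) (f : A → ℤ) →
    foldr _ (λ a b → f a + b) 0ℤ (V.tabulate h) ≡ ∑[ i < n ] f (h i)
  foldr-tabulate {zero} h f = refl
  foldr-tabulate {suc n} h f = cong (_+_ (f (h fzero))) (foldr-tabulate (h ∘ fsuc) f)

  sumV≡sum : (f : Fin n → ℤ) → sumV f ≡ sum f
  sumV≡sum = foldr-tabulate (λ i → i)

  ∑-zero : (f : Fin n → ℤ) → (∀ i → f i ≡ 0ℤ) → sum f ≡ 0ℤ
  ∑-zero {n} f f≗0 = trans (sum-cong-≗ f≗0) (sum-replicate-zero n)

  ∑-const : ∀ n (c : ℤ) → ∑[ i < n ] c ≡ + n * c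
  ∑-const zero c = refl
  ∑-const (suc n) c = trans (cong (_+_ c) (∑-const n c)) (lemma c (+ n))
    where
    lemma : ∀ c n → c + n * c ≡ (1ℤ + n) * c
    lemma = solve-∀

  ∑-neg : (f : Fin n → ℤ) → ∑[ i < n ] (- f i) ≡ - sum f
  ∑-neg f = begin
    ∑[ i < _ ] (- f i)      ≡⟨ sum-cong-≗ (λ i → sym (ℤP.-1*i≡-i (f i))) ⟩
    ∑[ i < _ ] (-1ℤ * f i)  ≡⟨ *-distribˡ-sum -1ℤ f ⟨
    -1ℤ * sum f             ≡⟨ ℤP.-1*i≡-i (sum f) ⟩
    - sum f                 ∎
    where open ≡-Reasoning

  ∑-distrib-- : (f g : Fin n → ℤ) → ∑[ i < n ] (f i - g i) ≡ sum f - sum g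
  ∑-distrib-- f g = trans (∑-distrib-+ f (λ i → - g i)) (cong (_+_ (sum f)) (∑-neg g))

  ∣-sum : ∀ {q} (f : Fin n → ℤ) → (∀ i → q ∣ f i) → q ∣ sum f
  ∣-sum {zero} {q} f q∣f = divides 0ℤ (sym (ℤP.*-zeroˡ q))
  ∣-sum {suc n} f q∣f = ∣m∣n⇒∣m+n (q∣f fzero) (∣-sum (f ∘ fsuc) (q∣f ∘ fsuc))

  𝟙 : Bool → ℤ
  𝟙 true = 1ℤ
  𝟙 false = 0ℤ

  ∑-𝟙== : (i₀ : Fin n) (g : Fin n → ℤ) → ∑[ i < n ] (𝟙 (i == i₀) * g i) ≡ g i₀
  ∑-𝟙== {suc n} fzero g = begin
    1ℤ * g fzero + ∑[ i < n ] (0ℤ * g (fsuc i))  ≡⟨ cong (_+_ (1ℤ * g fzero)) (∑-zero _ (λ i → ℤP.*-zeroˡ (g (fsuc i)))) ⟩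
    1ℤ * g fzero + 0ℤ                           ≡⟨ ℤP.+-identityʳ _ ⟩
    1ℤ * g fzero                                ≡⟨ ℤP.*-identityˡ _ ⟩
    g fzero                                     ∎
    where open ≡-Reasoning
  ∑-𝟙== {suc n} (fsuc i₀) g = trans (ℤP.+-identityˡ _) (∑-𝟙== i₀ (g ∘ fsuc))

  ∑-sucMod : (f : Fin (suc n) → ℤ) → ∑[ i < suc n ] f (sucMod i) ≡ sum f
  ∑-sucMod {n} f = begin
    ∑[ i < suc n ] f (sucMod i)                            ≡⟨ sum-init-last (f ∘ sucMod) ⟩
    ∑[ i < n ] f (sucMod (inject₁ i)) + f (sucMod (fromℕ n)) ≡⟨ cong₂ _+_ (sum-cong-≗ (cong f ∘ sucMod-inject₁)) (cong f (sucMod-fromℕ n)) ⟩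
    ∑[ i < n ] f (fsuc i) + f fzero                        ≡⟨ ℤP.+-comm _ (f fzero) ⟩
    sum f                                                  ∎
    where open ≡-Reasoning

  ∑² : (Fin a × Fin b → ℤ) → ℤ
  ∑² {a} {b} F = ∑[ k < a ] ∑[ i < b ] F (k , i)

  ∑²-sucLex : (F : Fin (suc a) × Fin (suc b) → ℤ) → ∑² (F ∘ sucLex) ≡ ∑² F
  ∑²-sucLex {a} {b} F = begin
    ∑[ k < suc a ] ∑[ i < suc b ] F (sucLex (k , i))          ≡⟨ sum-cong-≗ peelLast ⟩
    ∑[ k < suc a ] (rest k + F (sucMod k , fzero))            ≡⟨ ∑-distrib-+ rest (λ k → F (sucMod k , fzero)) ⟩
    sum rest + ∑[ k < suc a ] F (sucMod k , fzero)           ≡⟨ cong (_+_ (sum rest)) (∑-sucMod (λ k → F (k , fzero))) ⟩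
    sum rest + ∑[ k < suc a ] F (k , fzero)                  ≡⟨ ℤP.+-comm (sum rest) _ ⟩
    ∑[ k < suc a ] F (k , fzero) + sum rest                  ≡⟨ ∑-distrib-+ (λ k → F (k , fzero)) rest ⟨
    ∑² F                                                      ∎
    where
    open ≡-Reasoning
    rest : Fin (suc a) → ℤ
    rest k = ∑[ i < b ] F (k , fsuc i)
    restStep : ∀ k (i : Fin b) → F (sucLex (k , inject₁ i)) ≡ F (k , fsuc i)
    restStep k i rewrite ==-≢ (FP.fromℕ≢inject₁ {i = i} ∘ sym) | sucMod-inject₁ i = refl
    lastStep : ∀ k → F (sucLex (k , fromℕ b)) ≡ F (sucMod k , fzero)
    lastStep k rewrite ==-refl (fromℕ b) | sucMod-fromℕ b = refl
    peelLast : ∀ k → ∑[ i < suc b ] F (sucLex (k , i)) ≡ rest k + F (sucMod k , fzero)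
    peelLast k = trans (sum-init-last (λ i → F (sucLex (k , i))))
                       (cong₂ _+_ (sum-cong-≗ (restStep k)) (lastStep k))

  ∑-sucMod-telescope : (f : Fin (suc n) → ℤ) → ∑[ i < suc n ] (f i - f (sucMod i)) ≡ 0ℤ
  ∑-sucMod-telescope f = begin
    ∑[ i < _ ] (f i - f (sucMod i))        ≡⟨ ∑-distrib-- f (f ∘ sucMod) ⟩
    sum f - ∑[ i < _ ] f (sucMod i)        ≡⟨ cong (λ s → sum f - s) (∑-sucMod f) ⟩
    sum f - sum f                          ≡⟨ ℤP.+-inverseʳ (sum f) ⟩
    0ℤ                                     ∎
    where open ≡-Reasoning

  ∑²-distrib-+ : (F G : Fin a × Fin b → ℤ) → ∑² (λ r → F r + G r) ≡ ∑² F + ∑² G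
  ∑²-distrib-+ F G = trans (sum-cong-≗ (λ k → ∑-distrib-+ (λ i → F (k , i)) (λ i → G (k , i))))
                           (∑-distrib-+ (λ k → ∑[ i < _ ] F (k , i)) (λ k → ∑[ i < _ ] G (k , i)))

  ∑²-sucLex-telescope : (F : Fin (suc a) × Fin (suc b) → ℤ) → ∑² (λ r → F r - F (sucLex r)) ≡ 0ℤ
  ∑²-sucLex-telescope F = begin
    ∑² (λ r → F r - F (sucLex r))             ≡⟨ ∑²-distrib-+ F (λ r → - F (sucLex r)) ⟩
    ∑² F + ∑² (λ r → - F (sucLex r))          ≡⟨ cong (_+_ (∑² F)) (trans (sum-cong-≗ (λ k → ∑-neg (λ i → F (sucLex (k , i)))))
                                                                        (∑-neg (λ k → ∑[ i < _ ] F (sucLex (k , i))))) ⟩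
    ∑² F - ∑² (F ∘ sucLex)                    ≡⟨ cong (λ s → ∑² F - s) (∑²-sucLex F) ⟩
    ∑² F - ∑² F                               ≡⟨ ℤP.+-inverseʳ (∑² F) ⟩
    0ℤ                                        ∎
    where open ≡-Reasoning

module FormalChains where

  open import Data.Integer using (-_; _+_; _-_; _*_)
  open FiniteSums

  private
    variable
      N k : ℕ

  Tuple : ℕ → ℕ → Set
  Tuple N k = Vec (Fin N) k

  sumTuples : ∀ k → (Tuple N k → ℤ) → ℤ
  sumTuples zero F = F []
  sumTuples {N} (suc k) F = ∑[ u < N ] sumTuples k (λ r → F (u ∷ r))

  sumTuples-cong : ∀ k {F G : Tuple N k → ℤ} → (∀ y → F y ≡ G y) → sumTuples k F ≡ sumTuples k G
  sumTuples-cong zero F≗G = F≗G []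
  sumTuples-cong (suc k) F≗G = sum-cong-≗ (λ u → sumTuples-cong k (λ r → F≗G (u ∷ r)))

  *-distribˡ-sumTuples : ∀ k c (F : Tuple N k → ℤ) → c * sumTuples k F ≡ sumTuples k (λ y → c * F y)
  *-distribˡ-sumTuples zero c F = refl
  *-distribˡ-sumTuples (suc k) c F =
    trans (*-distribˡ-sum c (λ u → sumTuples k (λ r → F (u ∷ r)))) (sum-cong-≗ (λ u → *-distribˡ-sumTuples k c (λ r → F (u ∷ r))))

  sumTuples-comm-∑ : ∀ k {M} (F : Tuple N k → Fin M → ℤ) →
    sumTuples k (λ y → ∑[ i < M ] F y i) ≡ ∑[ i < M ] sumTuples k (λ y → F y i)
  sumTuples-comm-∑ zero F = refl
  sumTuples-comm-∑ (suc k) F = trans (sum-cong-≗ (λ u → sumTuples-comm-∑ k (λ r → F (u ∷ r)))) (∑-comm (λ u i → sumTuples k (λ r → F (u ∷ r) i)))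

  ∣-sumTuples : ∀ k {q} (F : Tuple N k → ℤ) → (∀ y → q ∣ F y) → q ∣ sumTuples k F
  ∣-sumTuples zero F q∣F = q∣F []
  ∣-sumTuples (suc k) F q∣F = ∣-sum _ (λ u → ∣-sumTuples k _ (λ r → q∣F (u ∷ r)))

  sumTuples-insertAt : ∀ k (p : Fin (suc k)) (F : Tuple N (suc k) → ℤ) →
    sumTuples k (λ y → ∑[ v < N ] F (insertAt y p v)) ≡ sumTuples (suc k) F
  sumTuples-insertAt k fzero F = sumTuples-comm-∑ k (λ y v → F (v ∷ y))
  sumTuples-insertAt (suc k) (fsuc p) F = sum-cong-≗ (λ u → sumTuples-insertAt k p (λ r → F (u ∷ r)))

  sumTuples-zero : ∀ k {F : Tuple N k → ℤ} → (∀ y → F y ≡ 0ℤ) → sumTuples k F ≡ 0ℤ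
  sumTuples-zero zero F≗0 = F≗0 []
  sumTuples-zero (suc k) F≗0 = ∑-zero _ (λ u → sumTuples-zero k (λ r → F≗0 (u ∷ r)))

  sumTuples-distrib-+ : ∀ k (F G : Tuple N k → ℤ) → sumTuples k (λ y → F y + G y) ≡ sumTuples k F + sumTuples k G
  sumTuples-distrib-+ zero F G = refl
  sumTuples-distrib-+ (suc k) F G = trans (sum-cong-≗ (λ u → sumTuples-distrib-+ k (λ r → F (u ∷ r)) (λ r → G (u ∷ r))))
    (∑-distrib-+ (λ u → sumTuples k (λ r → F (u ∷ r))) (λ u → sumTuples k (λ r → G (u ∷ r))))

  _=ᵗ_ : Tuple N k → Tuple N k → Bool
  x =ᵗ y = does (VP.≡-dec F._≟_ x y)

  ⟦_⟧ : Tuple N k → Tuple N k → ℤ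
  ⟦ t ⟧ y = 𝟙 (y =ᵗ t)

  ⟦⟧-≢ : {t y : Tuple N k} → y ≢ t → ⟦ t ⟧ y ≡ 0ℤ
  ⟦⟧-≢ {t = t} {y} y≢t = cong 𝟙 (dec-false (VP.≡-dec F._≟_ y t) y≢t)

  𝟙-∧ : ∀ a b → 𝟙 (a ∧ b) ≡ 𝟙 a * 𝟙 b
  𝟙-∧ true b = sym (ℤP.*-identityˡ (𝟙 b))
  𝟙-∧ false b = refl

  ⟦⟧-∷ : ∀ (t₀ u : Fin N) (t r : Tuple N k) → ⟦ t₀ ∷ t ⟧ (u ∷ r) ≡ 𝟙 (u == t₀) * ⟦ t ⟧ r
  ⟦⟧-∷ t₀ u t r = 𝟙-∧ (u == t₀) (r =ᵗ t)

  sumTuples-⟦⟧ : ∀ k (t : Tuple N k) (f : Tuple N k → ℤ) → sumTuples k (λ y → ⟦ t ⟧ y * f y) ≡ f t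
  sumTuples-⟦⟧ zero [] f = ℤP.*-identityˡ (f [])
  sumTuples-⟦⟧ {N} (suc k) (t₀ ∷ t) f = begin
    ∑[ u < N ] sumTuples k (λ r → ⟦ t₀ ∷ t ⟧ (u ∷ r) * f (u ∷ r))  ≡⟨ sum-cong-≗ pullOut ⟩
    ∑[ u < N ] (𝟙 (u == t₀) * sumTuples k (λ r → ⟦ t ⟧ r * f (u ∷ r)))  ≡⟨ ∑-𝟙== t₀ _ ⟩
    sumTuples k (λ r → ⟦ t ⟧ r * f (t₀ ∷ r))                      ≡⟨ sumTuples-⟦⟧ k t (λ r → f (t₀ ∷ r)) ⟩
    f (t₀ ∷ t)                                                    ∎
    where
    open ≡-Reasoning
    pullOut : ∀ u → sumTuples k (λ r → ⟦ t₀ ∷ t ⟧ (u ∷ r) * f (u ∷ r))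
                  ≡ 𝟙 (u == t₀) * sumTuples k (λ r → ⟦ t ⟧ r * f (u ∷ r))
    pullOut u = trans (sumTuples-cong k λ r → trans (cong (_* f (u ∷ r)) (⟦⟧-∷ t₀ u t r))
                                                    (ℤP.*-assoc (𝟙 (u == t₀)) _ _))
                      (sym (*-distribˡ-sumTuples k (𝟙 (u == t₀)) _))

  ∑-insertAt-⟦⟧ : ∀ k (p : Fin (suc k)) (t : Tuple N (suc k)) (y : Tuple N k) →
    ∑[ v < N ] ⟦ t ⟧ (insertAt y p v) ≡ ⟦ removeAt t p ⟧ y
  ∑-insertAt-⟦⟧ {N} k fzero (t₀ ∷ t) y =
    trans (sum-cong-≗ {N} (λ v → ⟦⟧-∷ t₀ v t y)) (∑-𝟙== t₀ (λ _ → ⟦ t ⟧ y))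
  ∑-insertAt-⟦⟧ {N} (suc k) (fsuc p) (t₀ ∷ t@(_ ∷ _)) (y₀ ∷ y) = begin
    ∑[ v < N ] ⟦ t₀ ∷ t ⟧ (y₀ ∷ insertAt y p v)        ≡⟨ sum-cong-≗ (λ v → ⟦⟧-∷ t₀ y₀ t (insertAt y p v)) ⟩
    ∑[ v < N ] (𝟙 (y₀ == t₀) * ⟦ t ⟧ (insertAt y p v)) ≡⟨ *-distribˡ-sum (𝟙 (y₀ == t₀)) (λ v → ⟦ t ⟧ (insertAt y p v)) ⟨
    𝟙 (y₀ == t₀) * ∑[ v < N ] ⟦ t ⟧ (insertAt y p v)   ≡⟨ cong (𝟙 (y₀ == t₀) *_) (∑-insertAt-⟦⟧ k p t y) ⟩
    𝟙 (y₀ == t₀) * ⟦ removeAt t p ⟧ y                  ≡⟨ ⟦⟧-∷ t₀ y₀ (removeAt t p) y ⟨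
    ⟦ t₀ ∷ removeAt t p ⟧ (y₀ ∷ y)                      ∎
    where open ≡-Reasoning

  LinComb : ℕ → ℕ → Set
  LinComb N k = List (ℤ × Tuple N k)

  ⟦_⟧ₗ : LinComb N k → Tuple N k → ℤ
  ⟦ [] ⟧ₗ y = 0ℤ
  ⟦ (c , t) ∷ L ⟧ₗ y = c * ⟦ t ⟧ y + ⟦ L ⟧ₗ y

  removeAtₗ : Fin (suc k) → LinComb N (suc k) → LinComb N k
  removeAtₗ p [] = []
  removeAtₗ p ((c , t) ∷ L) = (c , removeAt t p) ∷ removeAtₗ p L

  evalₗ : (Tuple N k → ℤ) → LinComb N k → ℤ
  evalₗ f [] = 0ℤ
  evalₗ f ((c , t) ∷ L) = c * f t + evalₗ f L

  sumTuples-*⟦⟧ₗ : ∀ k (f : Tuple N k → ℤ) (L : LinComb N k) → sumTuples k (λ y → f y * ⟦ L ⟧ₗ y) ≡ evalₗ f L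
  sumTuples-*⟦⟧ₗ k f [] = sumTuples-zero k (λ y → ℤP.*-zeroʳ (f y))
  sumTuples-*⟦⟧ₗ k f ((c , t) ∷ L) = begin
    sumTuples k (λ y → f y * (c * ⟦ t ⟧ y + ⟦ L ⟧ₗ y))
      ≡⟨ sumTuples-cong k (λ y → distribute (f y) c (⟦ t ⟧ y) (⟦ L ⟧ₗ y)) ⟩
    sumTuples k (λ y → c * (⟦ t ⟧ y * f y) + f y * ⟦ L ⟧ₗ y)
      ≡⟨ sumTuples-distrib-+ k (λ y → c * (⟦ t ⟧ y * f y)) (λ y → f y * ⟦ L ⟧ₗ y) ⟩
    sumTuples k (λ y → c * (⟦ t ⟧ y * f y)) + sumTuples k (λ y → f y * ⟦ L ⟧ₗ y)
      ≡⟨ cong₂ _+_ (sym (*-distribˡ-sumTuples k c (λ y → ⟦ t ⟧ y * f y))) (sumTuples-*⟦⟧ₗ k f L) ⟩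
    c * sumTuples k (λ y → ⟦ t ⟧ y * f y) + evalₗ f L
      ≡⟨ cong (λ s → c * s + evalₗ f L) (sumTuples-⟦⟧ k t f) ⟩
    c * f t + evalₗ f L ∎
    where
    open ≡-Reasoning
    distribute : ∀ a c b l → a * (c * b + l) ≡ c * (b * a) + a * l
    distribute = solve-∀

  ∑-insertAt-⟦⟧ₗ : ∀ {k} (p : Fin (suc k)) (L : LinComb N (suc k)) (y : Tuple N k) →
    ∑[ v < N ] ⟦ L ⟧ₗ (insertAt y p v) ≡ ⟦ removeAtₗ p L ⟧ₗ y
  ∑-insertAt-⟦⟧ₗ {N} p [] y = sum-replicate-zero N
  ∑-insertAt-⟦⟧ₗ {N} {k} p ((c , t) ∷ L) y = begin
    ∑[ v < N ] (c * ⟦ t ⟧ (insertAt y p v) + ⟦ L ⟧ₗ (insertAt y p v))  ≡⟨ ∑-distrib-+ (λ v → c * ⟦ t ⟧ (insertAt y p v)) (λ v → ⟦ L ⟧ₗ (insertAt y p v)) ⟩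
    ∑[ v < N ] (c * ⟦ t ⟧ (insertAt y p v)) + ∑[ v < N ] ⟦ L ⟧ₗ (insertAt y p v)
      ≡⟨ cong₂ _+_ (sym (*-distribˡ-sum c (λ v → ⟦ t ⟧ (insertAt y p v)))) (∑-insertAt-⟦⟧ₗ p L y) ⟩
    c * ∑[ v < N ] ⟦ t ⟧ (insertAt y p v) + ⟦ removeAtₗ p L ⟧ₗ y
      ≡⟨ cong (λ s → c * s + ⟦ removeAtₗ p L ⟧ₗ y) (∑-insertAt-⟦⟧ k p t y) ⟩
    c * ⟦ removeAt t p ⟧ y + ⟦ removeAtₗ p L ⟧ₗ y                   ∎
    where open ≡-Reasoning

  faceSign : ∀ {j} → Fin j → ℤ
  faceSign i = sgn (suc (toℕ i))

  rawBoundary : ∀ {j} → (Tuple N (suc (suc j)) → ℤ) → Tuple N (suc j) → ℤ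
  rawBoundary {N} {j} c y = ∑[ i < j ] (faceSign i * ∑[ v < N ] c (insertAt y (innerPos i) v))

  rawBoundary-* : ∀ {j} (a : ℤ) (c : Tuple N (suc (suc j)) → ℤ) y →
    rawBoundary (λ x → a * c x) y ≡ a * rawBoundary c y
  rawBoundary-* {N} {j} a c y = begin
    ∑[ i < j ] (faceSign i * ∑[ v < N ] (a * c (insertAt y (innerPos i) v)))
      ≡⟨ sum-cong-≗ (λ i → cong (faceSign i *_) (sym (*-distribˡ-sum a (λ v → c (insertAt y (innerPos i) v))))) ⟩
    ∑[ i < j ] (faceSign i * (a * ∑[ v < N ] c (insertAt y (innerPos i) v)))
      ≡⟨ sum-cong-≗ (λ i → swap (faceSign i) a (∑[ v < N ] c (insertAt y (innerPos i) v))) ⟩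
    ∑[ i < j ] (a * (faceSign i * ∑[ v < N ] c (insertAt y (innerPos i) v)))
      ≡⟨ *-distribˡ-sum a (λ i → faceSign i * ∑[ v < N ] c (insertAt y (innerPos i) v)) ⟨
    a * rawBoundary c y                                                                ∎
    where
    open ≡-Reasoning
    swap : ∀ s a x → s * (a * x) ≡ a * (s * x)
    swap = solve-∀

  rawBoundary-0 : ∀ {j} (y : Tuple N (suc j)) → rawBoundary {N} {j} (λ _ → 0ℤ) y ≡ 0ℤ
  rawBoundary-0 {N} {j} y =
    ∑-zero {j} (λ i → faceSign i * ∑[ v < N ] 0ℤ) (λ i → trans (cong (faceSign i *_) (sum-replicate-zero N)) (ℤP.*-zeroʳ (faceSign i)))

  rawBoundary-⟦⟧ₗ : ∀ {j} (L : LinComb N (suc (suc j))) (y : Tuple N (suc j)) →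
    rawBoundary ⟦ L ⟧ₗ y ≡ ∑[ i < j ] (faceSign i * ⟦ removeAtₗ (innerPos i) L ⟧ₗ y)
  rawBoundary-⟦⟧ₗ L y = sum-cong-≗ (λ i → cong (faceSign i *_) (∑-insertAt-⟦⟧ₗ (innerPos i) L y))

  rawBoundary-∑ : ∀ {j M} (c : Fin M → Tuple N (suc (suc j)) → ℤ) (y : Tuple N (suc j)) →
    rawBoundary (λ x → ∑[ r < M ] c r x) y ≡ ∑[ r < M ] rawBoundary (c r) y
  rawBoundary-∑ {N} {j} {M} c y = begin
    ∑[ i < j ] (faceSign i * ∑[ v < N ] ∑[ r < M ] c r (ins i v))    ≡⟨ sum-cong-≗ (λ i → cong (faceSign i *_) (∑-comm (λ v r → c r (ins i v)))) ⟩
    ∑[ i < j ] (faceSign i * ∑[ r < M ] ∑[ v < N ] c r (ins i v))    ≡⟨ sum-cong-≗ (λ i → *-distribˡ-sum (faceSign i) (λ r → ∑[ v < N ] c r (ins i v))) ⟩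
    ∑[ i < j ] ∑[ r < M ] (faceSign i * ∑[ v < N ] c r (ins i v))    ≡⟨ ∑-comm (λ i r → faceSign i * ∑[ v < N ] c r (ins i v)) ⟩
    ∑[ r < M ] rawBoundary (c r) y                            ∎
    where
    open ≡-Reasoning
    ins : Fin j → Fin N → Tuple N (suc (suc j))
    ins i v = insertAt y (innerPos i) v

  ∂≡rawBoundary : (G : Graph) (ℓ : ℕ) {j : ℕ} (c : Coeff G (suc j)) (y : Vec (Fin (size G)) (suc j)) →
    ∂ G ℓ c y ≡ (if isPath G ℓ y then rawBoundary c y else 0ℤ)
  ∂≡rawBoundary G ℓ {j} c y = cong (λ s → if isPath G ℓ y then s else 0ℤ) (begin
    sumV {j} (λ i → faceSign i * sumV (λ v → c (insertAt y (innerPos i) v)))  ≡⟨ sumV≡sum (λ i → faceSign i * sumV (λ v → c (insertAt y (innerPos i) v))) ⟩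
    ∑[ i < j ] (faceSign i * sumV (λ v → c (insertAt y (innerPos i) v)))
      ≡⟨ sum-cong-≗ (λ i → cong (faceSign i *_) (sumV≡sum (λ v → c (insertAt y (innerPos i) v)))) ⟩
    rawBoundary c y                                                                ∎)
    where open ≡-Reasoning

  module _ (G : Graph) (ℓ : ℕ) {j : ℕ} (c : Coeff G (suc j)) {y : Vec (Fin (size G)) (suc j)} where

    ∂-onPath : isPath G ℓ y ≡ true → ∂ G ℓ c y ≡ rawBoundary c y
    ∂-onPath y-path rewrite ∂≡rawBoundary G ℓ c y | y-path = refl

    ∂-offPath : isPath G ℓ y ≡ false → ∂ G ℓ c y ≡ 0ℤ
    ∂-offPath y-nonpath rewrite ∂≡rawBoundary G ℓ c y | y-nonpath = refl

    ∂-cases : ∀ {r} → (isPath G ℓ y ≡ true → rawBoundary c y ≡ r) → (isPath G ℓ y ≡ false → r ≡ 0ℤ) →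
      ∂ G ℓ c y ≡ r
    ∂-cases {r} onPath offPath = byPath (isPath G ℓ y) refl
      where
      byPath : ∀ b → isPath G ℓ y ≡ b → ∂ G ℓ c y ≡ r
      byPath true y-path = trans (∂-onPath y-path) (onPath y-path)
      byPath false y-nonpath = trans (∂-offPath y-nonpath) (sym (offPath y-nonpath))

  module _ (G : Graph) (ℓ : ℕ) where

    restrictToPaths : ∀ {j} → Coeff G j → Coeff G j
    restrictToPaths w y = if isPath G ℓ y then w y else 0ℤ

    restrict-onPath : ∀ {k} (w : Coeff G k) {y} → isPath G ℓ y ≡ true → restrictToPaths w y ≡ w y
    restrict-onPath w y-path rewrite y-path = refl

    restrict-zero : ∀ {k} (w : Coeff G k) {y} → w y ≡ 0ℤ → restrictToPaths w y ≡ 0ℤ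
    restrict-zero w {y} wy≡0 with isPath G ℓ y
    ... | true = wy≡0
    ... | false = refl

    δ : ∀ {j} → Coeff G j → Coeff G (suc j)
    δ {j} w x = ∑[ i < j ] (faceSign i * restrictToPaths w (removeAt x (innerPos i)))

    δ-vanishes : ∀ {j} (w : Coeff G j) (x : Vec (Fin (size G)) (suc (suc j))) →
      (∀ i → restrictToPaths w (removeAt x (innerPos i)) ≡ 0ℤ) → δ w x ≡ 0ℤ
    δ-vanishes {j} w x faces≡0 = ∑-zero {j} (λ i → faceSign i * restrictToPaths w (removeAt x (innerPos i)))
      (λ i → trans (cong (faceSign i *_) (faces≡0 i)) (ℤP.*-zeroʳ (faceSign i)))

    *-∂-expand : ∀ {j} (w : Coeff G j) (e : Coeff G (suc j)) y →
      w y * ∂ G ℓ e y ≡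
      ∑[ i < j ] (faceSign i * ∑[ v < size G ]
        (restrictToPaths w (removeAt (insertAt y (innerPos i) v) (innerPos i)) * e (insertAt y (innerPos i) v)))
    *-∂-expand {j} w e y = begin
      w y * ∂ G ℓ e y
        ≡⟨ trans (cong (w y *_) (∂≡rawBoundary G ℓ e y)) (restrict-* (isPath G ℓ y)) ⟩
      r * rawBoundary e y
        ≡⟨ *-distribˡ-sum r (λ i → faceSign i * ∑[ v < size G ] e (ins i v)) ⟩
      ∑[ i < j ] (r * (faceSign i * ∑[ v < size G ] e (ins i v)))
        ≡⟨ sum-cong-≗ (λ i → swap r (faceSign i) (∑[ v < size G ] e (ins i v))) ⟩
      ∑[ i < j ] (faceSign i * (r * ∑[ v < size G ] e (ins i v)))
        ≡⟨ sum-cong-≗ (λ i → cong (faceSign i *_) (*-distribˡ-sum r (λ v → e (ins i v)))) ⟩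
      ∑[ i < j ] (faceSign i * ∑[ v < size G ] (r * e (ins i v)))
        ≡⟨ sum-cong-≗ (λ i → cong (faceSign i *_) (sum-cong-≗ λ v →
             cong (λ y′ → restrictToPaths w y′ * e (ins i v)) (sym (VP.removeAt-insertAt y (innerPos i) v)))) ⟩
      ∑[ i < j ] (faceSign i * ∑[ v < size G ] (restrictToPaths w (removeAt (ins i v) (innerPos i)) * e (ins i v)))  ∎
      where
      open ≡-Reasoning
      r = restrictToPaths w y
      ins : Fin j → Fin (size G) → Vec (Fin (size G)) (suc (suc j))
      ins i v = insertAt y (innerPos i) v
      restrict-* : ∀ b → w y * (if b then rawBoundary e y else 0ℤ) ≡ (if b then w y else 0ℤ) * rawBoundary e y
      restrict-* true = refl
      restrict-* false = trans (ℤP.*-zeroʳ (w y)) (sym (ℤP.*-zeroˡ (rawBoundary e y)))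
      swap : ∀ a b c → a * (b * c) ≡ b * (a * c)
      swap = solve-∀

    ∂-δ-adjoint : ∀ {j} (w : Coeff G j) (e : Coeff G (suc j)) →
      sumTuples (suc j) (λ y → w y * ∂ G ℓ e y) ≡ sumTuples (suc (suc j)) (λ x → e x * δ w x)
    ∂-δ-adjoint {j} w e = begin
      sumTuples (suc j) (λ y → w y * ∂ G ℓ e y)
        ≡⟨ sumTuples-cong (suc j) (*-∂-expand w e) ⟩
      sumTuples (suc j) (λ y → ∑[ i < j ] (faceSign i * ∑[ v < size G ] H i (insertAt y (innerPos i) v)))
        ≡⟨ sumTuples-comm-∑ (suc j) (λ y i → faceSign i * ∑[ v < size G ] H i (insertAt y (innerPos i) v)) ⟩
      ∑[ i < j ] sumTuples (suc j) (λ y → faceSign i * ∑[ v < size G ] H i (insertAt y (innerPos i) v))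
        ≡⟨ sum-cong-≗ (λ i → sym (*-distribˡ-sumTuples (suc j) (faceSign i) (λ y → ∑[ v < size G ] H i (insertAt y (innerPos i) v)))) ⟩
      ∑[ i < j ] (faceSign i * sumTuples (suc j) (λ y → ∑[ v < size G ] H i (insertAt y (innerPos i) v)))
        ≡⟨ sum-cong-≗ (λ i → cong (faceSign i *_) (sumTuples-insertAt (suc j) (innerPos i) (H i))) ⟩
      ∑[ i < j ] (faceSign i * sumTuples (suc (suc j)) (H i))
        ≡⟨ sum-cong-≗ (λ i → *-distribˡ-sumTuples (suc (suc j)) (faceSign i) (H i)) ⟩
      ∑[ i < j ] sumTuples (suc (suc j)) (λ x → faceSign i * H i x)
        ≡⟨ sumTuples-comm-∑ (suc (suc j)) (λ x i → faceSign i * H i x) ⟨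
      sumTuples (suc (suc j)) (λ x → ∑[ i < j ] (faceSign i * H i x))
        ≡⟨ sumTuples-cong (suc (suc j)) collect ⟩
      sumTuples (suc (suc j)) (λ x → e x * δ w x)  ∎
      where
      open ≡-Reasoning
      H : Fin j → Coeff G (suc j)
      H i x = restrictToPaths w (removeAt x (innerPos i)) * e x
      collect : ∀ x → ∑[ i < j ] (faceSign i * H i x) ≡ e x * δ w x
      collect x = trans (sum-cong-≗ (λ i → rotate (faceSign i) (restrictToPaths w (removeAt x (innerPos i))) (e x)))
                        (sym (*-distribˡ-sum (e x) (λ i → faceSign i * restrictToPaths w (removeAt x (innerPos i)))))
        where
        rotate : ∀ a b c → a * (b * c) ≡ c * (a * b)
        rotate = solve-∀

    SupportedOnPaths : ∀ {k} → LinComb (size G) (suc k) → Set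
    SupportedOnPaths = All (λ ct → isPath G ℓ (proj₂ ct) ≡ true)

    ⟦⟧-offPath : ∀ {k} {t y : Tuple (size G) (suc k)} → isPath G ℓ t ≡ true → isPath G ℓ y ≡ false → ⟦ t ⟧ y ≡ 0ℤ
    ⟦⟧-offPath {t = t} {y} t-path y-nonpath =
      ⟦⟧-≢ {t = t} {y} (λ y≡t → true≢false (trans (sym t-path) (trans (cong (isPath G ℓ) (sym y≡t)) y-nonpath)))
      where
      true≢false : true ≢ false
      true≢false ()

    ⟦⟧ₗ-offPath : ∀ {k} {L : LinComb (size G) (suc k)} {y} → SupportedOnPaths L →
      isPath G ℓ y ≡ false → ⟦ L ⟧ₗ y ≡ 0ℤ
    ⟦⟧ₗ-offPath [] _ = refl
    ⟦⟧ₗ-offPath {L = (c , t) ∷ L} {y} (t-path ∷ rest) y-nonpath =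
      cong₂ _+_ (trans (cong (c *_) (⟦⟧-offPath {t = t} {y} t-path y-nonpath)) (ℤP.*-zeroʳ c)) (⟦⟧ₗ-offPath {L = L} rest y-nonpath)

module Walks (G : Graph) where

  open import Data.Nat using (_+_)

  private
    variable
      k t d L ℓ : ℕ
      x y z : Vx G

    any-tabulate⁻ : {A : Set} (f : A → Bool) (h : Fin n → A) →
      foldr _ (λ a b → f a ∨ b) false (V.tabulate h) ≡ true → ∃[ i ] f (h i) ≡ true
    any-tabulate⁻ {suc n} f h eq with f (h fzero) in fh₀
    ... | true = fzero , fh₀
    ... | false with any-tabulate⁻ f (λ i → h (fsuc i)) eq
    ...   | i , fhi = fsuc i , fhi

    any-tabulate⁺ : {A : Set} (f : A → Bool) (h : Fin n → A) (i : Fin n) → f (h i) ≡ true →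
      foldr _ (λ a b → f a ∨ b) false (V.tabulate h) ≡ true
    any-tabulate⁺ f h fzero fhi rewrite fhi = refl
    any-tabulate⁺ f h (fsuc i) fhi with f (h fzero)
    ... | true = refl
    ... | false = any-tabulate⁺ f (λ j → h (fsuc j)) i fhi

    anyV⁻ : (f : Fin n → Bool) → anyV f ≡ true → ∃[ i ] f i ≡ true
    anyV⁻ f = any-tabulate⁻ f (λ i → i)

    anyV⁺ : (f : Fin n → Bool) (i : Fin n) → f i ≡ true → anyV f ≡ true
    anyV⁺ f = any-tabulate⁺ f (λ i → i)

  reach-weaken : reach G t x y ≡ true → reach G (suc t) x y ≡ true
  reach-weaken walk rewrite walk = refl

  reach-snoc : reach G t x z ≡ true → adj G z y ≡ true → reach G (suc t) x y ≡ true
  reach-snoc {t} {x} {z} {y} walk edge with reach G t x y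
  ... | true = refl
  ... | false = anyV⁺ (λ w → reach G t x w ∧ adj G w y) z (cong₂ _∧_ walk edge)

  reach-refl : (x : Vx G) → reach G 0 x x ≡ true
  reach-refl = ==-refl

  reach-adj : adj G x y ≡ true → reach G 1 x y ≡ true
  reach-adj {x} {y} edge = reach-snoc {t = 0} {x} {x} {y} (reach-refl x) edge

  data ReachSuc (t : ℕ) (x y : Vx G) : Set where
    shorter : reach G t x y ≡ true → ReachSuc t x y
    snoc    : ∀ z → reach G t x z ≡ true → adj G z y ≡ true → ReachSuc t x y

  reach-suc⁻ : reach G (suc t) x y ≡ true → ReachSuc t x y
  reach-suc⁻ {t} {x} {y} walk with reach G t x y in short
  ... | true = shorter short
  ... | false with anyV⁻ (λ w → reach G t x w ∧ adj G w y) walk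
  ...   | z , walk-edge with reach G t x z in walk′
  ...     | true = snoc z walk′ walk-edge

  reach-trans : ∀ s → reach G s x y ≡ true → reach G t y z ≡ true → reach G (s + t) x z ≡ true
  reach-trans {x = x} {t = zero} s walk₁ walk₂ rewrite ℕP.+-identityʳ s =
    subst (λ w → reach G s x w ≡ true) (==⇒≡ walk₂) walk₁
  reach-trans {x} {y} {suc t} {z} s walk₁ walk₂ rewrite ℕP.+-suc s t with reach-suc⁻ {t} {y} {z} walk₂
  ... | shorter walk = reach-weaken {s + t} {x} {z} (reach-trans s walk₁ walk)
  ... | snoc w walk edge = reach-snoc {s + t} {x} {w} {z} (reach-trans s walk₁ walk) edge

  reach-≢⇒>0 : ∀ t → (x == y) ≡ false → reach G t x y ≡ true → 0 < t
  reach-≢⇒>0 zero x≢y walk with () ← trans (sym x≢y) walk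
  reach-≢⇒>0 (suc t) _ _ = s≤s z≤n

  distSearch-sound : ∀ fuel s → distSearch G fuel s x y ≡ just d → reach G d x y ≡ true
  distSearch-sound {x} {y} (suc fuel) s found with reach G s x y in walk
  ... | true = subst (λ d → reach G d x y ≡ true) (just-injective found) walk
  ... | false = distSearch-sound fuel (suc s) found

  dist-sound : dist G x y ≡ just d → reach G d x y ≡ true
  dist-sound = distSearch-sound (suc (size G)) 0

  distSearch-complete : ∀ fuel s → s ≤ t → t < s + fuel → reach G t x y ≡ true →
    ∃[ d ] distSearch G fuel s x y ≡ just d × d ≤ t
  distSearch-complete {t} zero s s≤t t<s+0 walk =
    ⊥-elim (ℕP.<-irrefl refl (ℕP.<-≤-trans t<s+0 (ℕP.≤-trans (ℕP.≤-reflexive (ℕP.+-identityʳ s)) s≤t)))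
  distSearch-complete {t} {x} {y} (suc fuel) s s≤t t<s+fuel walk with reach G s x y in found
  ... | true = s , refl , s≤t
  ... | false with ℕP.m≤n⇒m<n∨m≡n s≤t
  ...   | inj₁ s<t = distSearch-complete fuel (suc s) s<t (subst (t <_) (ℕP.+-suc s fuel) t<s+fuel) walk
  ...   | inj₂ refl with () ← trans (sym found) walk

  dist-complete : reach G t x y ≡ true → t ≤ size G → ∃[ d ] dist G x y ≡ just d × d ≤ t
  dist-complete walk t≤size = distSearch-complete (suc (size G)) 0 z≤n (s≤s t≤size) walk

  pathLen-∷∷⁻ : (r : Vec (Vx G) k) → pathLen G (x ∷ y ∷ r) ≡ just L →
    (x == y) ≡ false × ∃[ d ] ∃[ L′ ] dist G x y ≡ just d × pathLen G (y ∷ r) ≡ just L′ × L ≡ d + L′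
  pathLen-∷∷⁻ {x = x} {y} r eq with x == y | dist G x y | pathLen G (y ∷ r)
  pathLen-∷∷⁻ r refl | false | just d | just L′ = refl , d , L′ , refl , refl , refl

  pathLen-∷∷⁺ : (r : Vec (Vx G) k) → (x == y) ≡ false → dist G x y ≡ just d →
    pathLen G (y ∷ r) ≡ just L → pathLen G (x ∷ y ∷ r) ≡ just (d + L)
  pathLen-∷∷⁺ r x≢y dxy rest rewrite x≢y | dxy | rest = refl

  isPath⁻ : (v : Vec (Vx G) (suc k)) → isPath G ℓ v ≡ true → pathLen G v ≡ just ℓ
  isPath⁻ {ℓ = ℓ} v eq with pathLen G v
  ... | just l = cong just (≡ᵇ⇒≡ eq)

  isPath⁺ : (v : Vec (Vx G) (suc k)) → pathLen G v ≡ just ℓ → isPath G ℓ v ≡ true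
  isPath⁺ {ℓ = ℓ} v eq rewrite eq = ≡ᵇ-refl ℓ

-- The bound rank≤size only serves to keep geodesics within the search range of `dist`.
module Graded (G : Graph) (rank : Vx G → ℕ)
  (rank-adj : ∀ {x y} → adj G x y ≡ true → rank y ≤ suc (rank x))
  (rank≤size : ∀ x → rank x ≤ size G) where

  open import Data.Nat using (_+_)
  open Walks G

  private
    variable
      k t L : ℕ
      x y z : Vx G

    last-∷ : {A : Set} (x : A) (v : Vec A (suc k)) → V.last (x ∷ v) ≡ V.last v
    last-∷ x v = begin
      V.last (x ∷ v)          ≡⟨ cong (λ u → V.last (x ∷ u)) eq ⟩
      V.last ((x ∷ ys) ∷ʳ l)  ≡⟨ VP.last-∷ʳ l (x ∷ ys) ⟩
      l                       ≡⟨ VP.last-∷ʳ l ys ⟨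
      V.last (ys ∷ʳ l)        ≡⟨ cong V.last eq ⟨
      V.last v                ∎
      where
      open ≡-Reasoning
      ys = proj₁ (initLast v)
      l = proj₁ (proj₂ (initLast v))
      eq = proj₂ (proj₂ (initLast v))

    squeeze : ∀ {a b c e} → a ≤ c → b ≤ a + e → b ≡ c + e → a ≡ c
    squeeze {a} {b} {c} {e} a≤c b≤a+e b≡c+e =
      ℕP.≤-antisym a≤c (ℕP.+-cancelʳ-≤ e c a (subst (_≤ a + e) b≡c+e b≤a+e))

  reach⇒rank≤ : reach G t x y ≡ true → rank y ≤ rank x + t
  reach⇒rank≤ {zero} {x} walk = subst (λ w → rank w ≤ rank x + 0) (==⇒≡ walk) (ℕP.m≤m+n (rank x) 0)
  reach⇒rank≤ {suc t} {x} {y} walk with reach-suc⁻ {t} {x} {y} walk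
  ... | shorter walk′ = ℕP.≤-trans (reach⇒rank≤ {t} walk′) (ℕP.+-monoʳ-≤ (rank x) (ℕP.n≤1+n t))
  ... | snoc z walk′ edge = ℕP.≤-trans (rank-adj edge)
          (ℕP.≤-trans (s≤s (reach⇒rank≤ {t} walk′)) (ℕP.≤-reflexive (sym (ℕP.+-suc (rank x) t))))

  geodesic-induction : (P : Vx G → Set) → P x →
    (∀ {u v} → P u → adj G u v ≡ true → rank v ≡ suc (rank u) → P v) →
    reach G t x y ≡ true → rank y ≡ rank x + t → P y
  geodesic-induction {t = zero} P Px step walk _ = subst P (==⇒≡ walk) Px
  geodesic-induction {x} {suc t} {y} P Px step walk geodesic with reach-suc⁻ {t} {x} {y} walk
  ... | shorter walk′ =
    ⊥-elim (ℕP.<-irrefl refl (ℕP.<-≤-trans tooHigh (reach⇒rank≤ walk′)))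
    where
    tooHigh : rank x + t < rank y
    tooHigh = subst (rank x + t <_) (sym geodesic) (ℕP.+-monoʳ-< (rank x) (ℕP.n<1+n t))
  ... | snoc z walk′ edge = step (geodesic-induction P Px step walk′ rank-z) edge rank-y
    where
    rank-z : rank z ≡ rank x + t
    rank-z = squeeze (reach⇒rank≤ walk′) (ℕP.≤-trans (rank-adj edge) (ℕP.≤-reflexive (ℕP.+-comm 1 (rank z))))
               (trans geodesic (trans (ℕP.+-suc (rank x) t) (ℕP.+-comm 1 (rank x + t))))
    rank-y : rank y ≡ suc (rank z)
    rank-y = trans geodesic (trans (ℕP.+-suc (rank x) t) (cong suc (sym rank-z)))

  geodesic-dist : reach G t x y ≡ true → rank y ≡ rank x + t → dist G x y ≡ just t
  geodesic-dist {t} {x} {y} walk geodesic with dist-complete walk t≤size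
    where
    t≤size : t ≤ size G
    t≤size = ℕP.≤-trans (ℕP.m≤n+m t (rank x)) (ℕP.≤-trans (ℕP.≤-reflexive (sym geodesic)) (rank≤size y))
  ... | d , found , d≤t = trans found (cong just (ℕP.≤-antisym d≤t t≤d))
    where
    t≤d : t ≤ d
    t≤d = ℕP.+-cancelˡ-≤ (rank x) t d
            (ℕP.≤-trans (ℕP.≤-reflexive (sym geodesic)) (reach⇒rank≤ (dist-sound found)))

  record Rises (x y : Vx G) : Set where
    constructor rises
    field
      gap      : ℕ
      gap>0    : 0 < gap
      walk     : reach G gap x y ≡ true
      rank-gap : rank y ≡ rank x + gap

  open Rises public

  rises-trans : Rises x y → Rises y z → Rises x z
  rises-trans {x} (rises d₁ d₁>0 walk₁ rank₁) (rises d₂ _ walk₂ rank₂) =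
    rises (d₁ + d₂) (ℕP.<-≤-trans d₁>0 (ℕP.m≤m+n d₁ d₂)) (reach-trans d₁ walk₁ walk₂)
          (trans rank₂ (trans (cong (_+ d₂) rank₁) (ℕP.+-assoc (rank x) d₁ d₂)))

  rises-rank< : Rises x y → rank x < rank y
  rises-rank< {x} ρ = subst (rank x <_) (sym (rank-gap ρ))
    (subst (_< rank x + gap ρ) (ℕP.+-identityʳ (rank x)) (ℕP.+-monoʳ-< (rank x) (gap>0 ρ)))

  rises-≢ : Rises x y → (x == y) ≡ false
  rises-≢ ρ = ==-≢ (λ x≡y → ℕP.<-irrefl (cong rank x≡y) (rises-rank< ρ))

  rises-dist : (ρ : Rises x y) → dist G x y ≡ just (gap ρ)
  rises-dist ρ = geodesic-dist (walk ρ) (rank-gap ρ)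

  data Ascent : Vec (Vx G) (suc k) → ℕ → Set where
    [_] : ∀ x → Ascent (x ∷ []) 0
    _∷_ : ∀ {x y L} {r : Vec (Vx G) k} (ρ : Rises x y) → Ascent (y ∷ r) L → Ascent (x ∷ y ∷ r) (gap ρ + L)

  ascent-pathLen : {v : Vec (Vx G) (suc k)} → Ascent v L → pathLen G v ≡ just L
  ascent-pathLen [ x ] = refl
  ascent-pathLen {v = x ∷ y ∷ r} (ρ ∷ a) = pathLen-∷∷⁺ r (rises-≢ ρ) (rises-dist ρ) (ascent-pathLen a)

  ascent-removeInner : ∀ {j} {v : Vec (Vx G) (suc (suc j))} → Ascent v L → (i : Fin j) →
    Ascent (removeAt v (innerPos i)) L
  ascent-removeInner (ρ₁ ∷ (ρ₂ ∷ a)) fzero =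
    subst (Ascent _) (ℕP.+-assoc (gap ρ₁) (gap ρ₂) _) (rises-trans ρ₁ ρ₂ ∷ a)
  ascent-removeInner {v = x ∷ y ∷ z ∷ r} (ρ ∷ a) (fsuc i) = ρ ∷ ascent-removeInner a i

  pathLen⇒rank≤ : (v : Vec (Vx G) (suc k)) → pathLen G v ≡ just L → rank (V.last v) ≤ rank (V.head v) + L
  pathLen⇒rank≤ (x ∷ []) refl = ℕP.m≤m+n (rank x) 0
  pathLen⇒rank≤ (x ∷ y ∷ r) len with pathLen-∷∷⁻ r len
  ... | _ , d , L′ , dxy , rest , refl = begin
    rank (V.last (x ∷ y ∷ r))  ≡⟨ cong rank (last-∷ x (y ∷ r)) ⟩
    rank (V.last (y ∷ r))      ≤⟨ pathLen⇒rank≤ (y ∷ r) rest ⟩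
    rank y + L′                ≤⟨ ℕP.+-monoˡ-≤ L′ (reach⇒rank≤ (dist-sound dxy)) ⟩
    rank x + d + L′            ≡⟨ ℕP.+-assoc (rank x) d L′ ⟩
    rank x + (d + L′)          ∎
    where open ℕP.≤-Reasoning

  tight⇒ascent : (v : Vec (Vx G) (suc k)) → pathLen G v ≡ just L →
    rank (V.last v) ≡ rank (V.head v) + L → Ascent v L
  tight⇒ascent (x ∷ []) refl _ = [ x ]
  tight⇒ascent (x ∷ y ∷ r) len tight with pathLen-∷∷⁻ r len
  ... | x≢y , d , L′ , dxy , rest , refl = rises d d>0 walk-xy rank-y ∷ tight⇒ascent (y ∷ r) rest rank-last
    where
    walk-xy = dist-sound dxy
    last≤ : rank (V.last (y ∷ r)) ≤ rank y + L′
    last≤ = pathLen⇒rank≤ (y ∷ r) rest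
    last≡ : rank (V.last (y ∷ r)) ≡ rank x + d + L′
    last≡ = trans (cong rank (sym (last-∷ x (y ∷ r)))) (trans tight (sym (ℕP.+-assoc (rank x) d L′)))
    rank-y : rank y ≡ rank x + d
    rank-y = squeeze (reach⇒rank≤ walk-xy) last≤ last≡
    rank-last : rank (V.last (y ∷ r)) ≡ rank y + L′
    rank-last = trans last≡ (cong (_+ L′) (sym rank-y))
    d>0 : 0 < d
    d>0 = reach-≢⇒>0 d x≢y walk-xy

  ascent-rank : {v : Vec (Vx G) (suc k)} → Ascent v L → rank (V.last v) ≡ rank (V.head v) + L
  ascent-rank [ x ] = sym (ℕP.+-identityʳ (rank x))
  ascent-rank {v = x ∷ y ∷ r} (ρ ∷ a) = begin
    rank (V.last (x ∷ y ∷ r))  ≡⟨ cong rank (last-∷ x (y ∷ r)) ⟩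
    rank (V.last (y ∷ r))      ≡⟨ ascent-rank a ⟩
    rank y + _                 ≡⟨ cong (_+ _) (rank-gap ρ) ⟩
    rank x + gap ρ + _         ≡⟨ ℕP.+-assoc (rank x) (gap ρ) _ ⟩
    rank x + (gap ρ + _)       ∎
    where open ≡-Reasoning

module HasseDiagram (Q M S : ℕ) where

  open import Data.Nat using (_+_; _*_)

  q m s : ℕ
  q = suc Q
  m = suc M
  s = suc S

  Cell : Set
  Cell = Fin q × Fin m

  data El : Set where
    bot top : El
    bv gv   : Cell → El
    av      : Fin m → El
    ev      : Fin m → Fin s → El
    cv      : Fin s → El

  rank : El → ℕ
  rank bot = 0
  rank (bv _) = 1
  rank (gv _) = 2
  rank (av _) = 2
  rank (ev _ j) = 3 + toℕ j
  rank (cv j) = 3 + toℕ j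
  rank top = 3 + s

  infix 4 _⋖_

  data _⋖_ : El → El → Set where
    bot⋖b : ∀ r → bot ⋖ bv r
    b⋖g   : ∀ r → bv r ⋖ gv r
    b⋖g′  : ∀ r → bv (sucLex r) ⋖ gv r
    b⋖a   : ∀ k i → bv (k , i) ⋖ av i
    g⋖e   : ∀ k i → gv (k , i) ⋖ ev i fzero
    g⋖c   : ∀ r → gv r ⋖ cv fzero
    a⋖e   : ∀ i → av i ⋖ ev i fzero
    a⋖e′  : ∀ i → av (sucMod i) ⋖ ev i fzero
    e⋖e   : ∀ i j j′ → toℕ j′ ≡ suc (toℕ j) → ev i j ⋖ ev i j′
    c⋖c   : ∀ j j′ → toℕ j′ ≡ suc (toℕ j) → cv j ⋖ cv j′
    e⋖top : ∀ i → ev i (fromℕ S) ⋖ top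
    c⋖top : cv (fromℕ S) ⋖ top

  ⋖-rank : ∀ {u v} → u ⋖ v → rank v ≡ suc (rank u)
  ⋖-rank (bot⋖b r) = refl
  ⋖-rank (b⋖g r) = refl
  ⋖-rank (b⋖g′ r) = refl
  ⋖-rank (b⋖a k i) = refl
  ⋖-rank (g⋖e k i) = refl
  ⋖-rank (g⋖c r) = refl
  ⋖-rank (a⋖e i) = refl
  ⋖-rank (a⋖e′ i) = refl
  ⋖-rank (e⋖e i j j′ j′≡1+j) = cong (_+_ 3) j′≡1+j
  ⋖-rank (c⋖c j j′ j′≡1+j) = cong (_+_ 3) j′≡1+j
  ⋖-rank (e⋖top i) = cong (_+_ 4) (sym (FP.toℕ-fromℕ S))
  ⋖-rank c⋖top = cong (_+_ 4) (sym (FP.toℕ-fromℕ S))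

  _==ᶜ_ : Cell → Cell → Bool
  (k , i) ==ᶜ (k′ , i′) = (k == k′) ∧ (i == i′)

  ==ᶜ⇒≡ : ∀ {r r′} → (r ==ᶜ r′) ≡ true → r ≡ r′
  ==ᶜ⇒≡ {k , i} {k′ , i′} eq with k == k′ in k≡k′
  ... | true = cong₂ _,_ (==⇒≡ k≡k′) (==⇒≡ eq)

  ==ᶜ-refl : ∀ r → (r ==ᶜ r) ≡ true
  ==ᶜ-refl (k , i) rewrite ==-refl k = ==-refl i

  covers : El → El → Bool
  covers bot (bv _) = true
  covers (bv r) (gv r′) = (r ==ᶜ r′) ∨ (r ==ᶜ sucLex r′)
  covers (bv (_ , i)) (av i′) = i == i′
  covers (gv (_ , i)) (ev i′ j) = (i == i′) ∧ (j == fzero)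
  covers (gv _) (cv j) = j == fzero
  covers (av i) (ev i′ j) = ((i == i′) ∨ (i == sucMod i′)) ∧ (j == fzero)
  covers (ev i j) (ev i′ j′) = (i == i′) ∧ (toℕ j′ ℕ.≡ᵇ suc (toℕ j))
  covers (cv j) (cv j′) = toℕ j′ ℕ.≡ᵇ suc (toℕ j)
  covers (ev _ j) top = j == fromℕ S
  covers (cv j) top = j == fromℕ S
  covers _ _ = false

  covers⇒⋖ : ∀ u v → covers u v ≡ true → u ⋖ v
  covers⇒⋖ bot (bv r) _ = bot⋖b r
  covers⇒⋖ (bv r) (gv r′) eq with ∨≡true⁻ {r ==ᶜ r′} eq
  ... | inj₁ same with refl ← ==ᶜ⇒≡ {r} {r′} same = b⋖g r′
  ... | inj₂ next with refl ← ==ᶜ⇒≡ {r} {sucLex r′} next = b⋖g′ r′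
  covers⇒⋖ (bv (k , i)) (av i′) eq with refl ← ==⇒≡ {i = i} {i′} eq = b⋖a k i′
  covers⇒⋖ (gv (k , i)) (ev i′ j) eq with ∧≡true⁻ {i == i′} eq
  ... | same , first with refl ← ==⇒≡ {i = i} {i′} same | refl ← ==⇒≡ {i = j} {fzero} first = g⋖e k i′
  covers⇒⋖ (gv r) (cv j) eq with refl ← ==⇒≡ {i = j} {fzero} eq = g⋖c r
  covers⇒⋖ (av i) (ev i′ j) eq with ∧≡true⁻ {(i == i′) ∨ (i == sucMod i′)} eq
  ... | either , first with refl ← ==⇒≡ {i = j} {fzero} first | ∨≡true⁻ {i == i′} either
  ...   | inj₁ same with refl ← ==⇒≡ {i = i} {i′} same = a⋖e i′
  ...   | inj₂ next with refl ← ==⇒≡ {i = i} {sucMod i′} next = a⋖e′ i′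
  covers⇒⋖ (ev i j) (ev i′ j′) eq with ∧≡true⁻ {i == i′} eq
  ... | same , step with refl ← ==⇒≡ {i = i} {i′} same = e⋖e i′ j j′ (≡ᵇ⇒≡ step)
  covers⇒⋖ (cv j) (cv j′) eq = c⋖c j j′ (≡ᵇ⇒≡ eq)
  covers⇒⋖ (ev i j) top eq with refl ← ==⇒≡ {i = j} {fromℕ S} eq = e⋖top i
  covers⇒⋖ (cv j) top eq with refl ← ==⇒≡ {i = j} {fromℕ S} eq = c⋖top

  ⋖⇒covers : ∀ {u v} → u ⋖ v → covers u v ≡ true
  ⋖⇒covers (bot⋖b r) = refl
  ⋖⇒covers (b⋖g r) rewrite ==ᶜ-refl r = refl
  ⋖⇒covers (b⋖g′ r) rewrite ==ᶜ-refl (sucLex r) = ∨-comm _ true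
  ⋖⇒covers (b⋖a k i) = ==-refl i
  ⋖⇒covers (g⋖e k i) rewrite ==-refl i = refl
  ⋖⇒covers (g⋖c r) = refl
  ⋖⇒covers (a⋖e i) rewrite ==-refl i = refl
  ⋖⇒covers (a⋖e′ i) rewrite ==-refl (sucMod i) | ∨-comm (sucMod i == i) true = refl
  ⋖⇒covers (e⋖e i j j′ j′≡1+j) rewrite ==-refl i | j′≡1+j = ≡ᵇ-refl (suc (toℕ j))
  ⋖⇒covers (c⋖c j j′ j′≡1+j) rewrite j′≡1+j = ≡ᵇ-refl (suc (toℕ j))
  ⋖⇒covers (e⋖top i) = ==-refl (fromℕ S)
  ⋖⇒covers c⋖top = ==-refl (fromℕ S)

  infix 4 _≼_

  data _≼_ : El → El → Set where
    ≼-bot  : ∀ u → bot ≼ u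
    ≼-top  : ∀ u → u ≼ top
    ≼-refl : ∀ u → u ≼ u
    b≼g    : ∀ r → bv r ≼ gv r
    b≼g′   : ∀ r → bv (sucLex r) ≼ gv r
    b≼a    : ∀ k i → bv (k , i) ≼ av i
    b≼e    : ∀ k i j → bv (k , i) ≼ ev i j
    b≼e′   : ∀ k i j → bv (k , sucMod i) ≼ ev i j
    b≼c    : ∀ r j → bv r ≼ cv j
    g≼e    : ∀ k i j → gv (k , i) ≼ ev i j
    g≼c    : ∀ r j → gv r ≼ cv j
    a≼e    : ∀ i j → av i ≼ ev i j
    a≼e′   : ∀ i j → av (sucMod i) ≼ ev i j
    e≼e    : ∀ i j j′ → ev i j ≼ ev i j′
    c≼c    : ∀ j j′ → cv j ≼ cv j′

  ⋖⇒≼ : ∀ {u v} → u ⋖ v → u ≼ v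
  ⋖⇒≼ (bot⋖b r) = ≼-bot _
  ⋖⇒≼ (b⋖g r) = b≼g r
  ⋖⇒≼ (b⋖g′ r) = b≼g′ r
  ⋖⇒≼ (b⋖a k i) = b≼a k i
  ⋖⇒≼ (g⋖e k i) = g≼e k i fzero
  ⋖⇒≼ (g⋖c r) = g≼c r fzero
  ⋖⇒≼ (a⋖e i) = a≼e i fzero
  ⋖⇒≼ (a⋖e′ i) = a≼e′ i fzero
  ⋖⇒≼ (e⋖e i j j′ _) = e≼e i j j′
  ⋖⇒≼ (c⋖c j j′ _) = c≼c j j′
  ⋖⇒≼ (e⋖top i) = ≼-top _
  ⋖⇒≼ c⋖top = ≼-top _

  ≼-⋖-trans : ∀ {x u v} → x ≼ u → u ⋖ v → x ≼ v
  ≼-⋖-trans (≼-bot _) _ = ≼-bot _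
  ≼-⋖-trans (≼-refl _) u⋖v = ⋖⇒≼ u⋖v
  ≼-⋖-trans (b≼g (k , i)) (g⋖e .k .i) = b≼e k i fzero
  ≼-⋖-trans (b≼g r) (g⋖c .r) = b≼c r fzero
  ≼-⋖-trans (b≼g′ (k , i)) (g⋖e .k .i) = b≼e′ _ i fzero
  ≼-⋖-trans (b≼g′ r) (g⋖c .r) = b≼c _ fzero
  ≼-⋖-trans (b≼a k i) (a⋖e .i) = b≼e k i fzero
  ≼-⋖-trans (b≼a k .(sucMod i)) (a⋖e′ i) = b≼e′ k i fzero
  ≼-⋖-trans (b≼e k i j) (e⋖e .i .j j′ _) = b≼e k i j′
  ≼-⋖-trans (b≼e k i _) (e⋖top .i) = ≼-top _
  ≼-⋖-trans (b≼e′ k i j) (e⋖e .i .j j′ _) = b≼e′ k i j′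
  ≼-⋖-trans (b≼e′ k i _) (e⋖top .i) = ≼-top _
  ≼-⋖-trans (b≼c r j) (c⋖c .j j′ _) = b≼c r j′
  ≼-⋖-trans (b≼c r _) c⋖top = ≼-top _
  ≼-⋖-trans (g≼e k i j) (e⋖e .i .j j′ _) = g≼e k i j′
  ≼-⋖-trans (g≼e k i _) (e⋖top .i) = ≼-top _
  ≼-⋖-trans (g≼c r j) (c⋖c .j j′ _) = g≼c r j′
  ≼-⋖-trans (g≼c r _) c⋖top = ≼-top _
  ≼-⋖-trans (a≼e i j) (e⋖e .i .j j′ _) = a≼e i j′
  ≼-⋖-trans (a≼e i _) (e⋖top .i) = ≼-top _
  ≼-⋖-trans (a≼e′ i j) (e⋖e .i .j j′ _) = a≼e′ i j′
  ≼-⋖-trans (a≼e′ i _) (e⋖top .i) = ≼-top _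
  ≼-⋖-trans (e≼e i j j′) (e⋖e .i .j′ j″ _) = e≼e i j j″
  ≼-⋖-trans (e≼e i j _) (e⋖top .i) = ≼-top _
  ≼-⋖-trans (c≼c j j′) (c⋖c .j′ j″ _) = c≼c j j″
  ≼-⋖-trans (c≼c j _) c⋖top = ≼-top _

  cells : ℕ
  cells = q * m

  interior : ℕ
  interior = cells + (cells + (m + (m * s + s)))

  -- Opaque so that the distance search in `isPath`, whose fuel is the vertex count, never unfolds
  -- during type checking.
  opaque
    vertices : ℕ
    vertices = 2 + interior

    vertices≡ : vertices ≡ 2 + interior
    vertices≡ = refl

  decode′ : Fin (2 + interior) → El
  decode′ fzero = bot
  decode′ (fsuc fzero) = top
  decode′ (fsuc (fsuc x)) =
    [ bv ∘ remQuot m ,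
    [ gv ∘ remQuot m ,
    [ av ,
    [ uncurry ev ∘ remQuot s , cv ]′ ∘ splitAt (m * s) ]′ ∘ splitAt m ]′ ∘ splitAt cells ]′ (splitAt cells x)

  encode′ : El → Fin (2 + interior)
  encode′ bot = fzero
  encode′ top = fsuc fzero
  encode′ (bv (k , i)) = fsuc (fsuc (combine k i ↑ˡ _))
  encode′ (gv (k , i)) = fsuc (fsuc (cells ↑ʳ (combine k i ↑ˡ _)))
  encode′ (av i) = fsuc (fsuc (cells ↑ʳ (cells ↑ʳ (i ↑ˡ _))))
  encode′ (ev i j) = fsuc (fsuc (cells ↑ʳ (cells ↑ʳ (m ↑ʳ (combine i j ↑ˡ _)))))
  encode′ (cv j) = fsuc (fsuc (cells ↑ʳ (cells ↑ʳ (m ↑ʳ ((m * s) ↑ʳ j)))))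

  decode′-encode′ : ∀ u → decode′ (encode′ u) ≡ u
  decode′-encode′ bot = refl
  decode′-encode′ top = refl
  decode′-encode′ (bv (k , i))
    rewrite FP.splitAt-↑ˡ cells (combine k i) (cells + (m + (m * s + s))) = cong bv (FP.remQuot-combine k i)
  decode′-encode′ (gv (k , i))
    rewrite FP.splitAt-↑ʳ cells (cells + (m + (m * s + s))) (combine k i ↑ˡ _)
          | FP.splitAt-↑ˡ cells (combine k i) (m + (m * s + s)) = cong gv (FP.remQuot-combine k i)
  decode′-encode′ (av i)
    rewrite FP.splitAt-↑ʳ cells (cells + (m + (m * s + s))) (cells ↑ʳ (i ↑ˡ _))
          | FP.splitAt-↑ʳ cells (m + (m * s + s)) (i ↑ˡ _)
          | FP.splitAt-↑ˡ m i (m * s + s) = refl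
  decode′-encode′ (ev i j)
    rewrite FP.splitAt-↑ʳ cells (cells + (m + (m * s + s))) (cells ↑ʳ (m ↑ʳ (combine i j ↑ˡ _)))
          | FP.splitAt-↑ʳ cells (m + (m * s + s)) (m ↑ʳ (combine i j ↑ˡ _))
          | FP.splitAt-↑ʳ m (m * s + s) (combine i j ↑ˡ _)
          | FP.splitAt-↑ˡ (m * s) (combine i j) s = cong (uncurry ev) (FP.remQuot-combine i j)
  decode′-encode′ (cv j)
    rewrite FP.splitAt-↑ʳ cells (cells + (m + (m * s + s))) (cells ↑ʳ (m ↑ʳ ((m * s) ↑ʳ j)))
          | FP.splitAt-↑ʳ cells (m + (m * s + s)) (m ↑ʳ ((m * s) ↑ʳ j))
          | FP.splitAt-↑ʳ m (m * s + s) ((m * s) ↑ʳ j)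
          | FP.splitAt-↑ʳ (m * s) s j = refl

  decode : Fin vertices → El
  decode x = decode′ (F.cast vertices≡ x)

  encode : El → Fin vertices
  encode u = F.cast (sym vertices≡) (encode′ u)

  decode-encode : ∀ u → decode (encode u) ≡ u
  decode-encode u = trans (cong decode′ (FP.cast-involutive vertices≡ (sym vertices≡) (encode′ u))) (decode′-encode′ u)

  covers-irrefl : ∀ u → covers u u ≡ false
  covers-irrefl u with covers u u in u⋖u
  ... | false = refl
  ... | true = ⊥-elim (ℕP.1+n≢n (sym (⋖-rank (covers⇒⋖ u u u⋖u))))

  Hasse : Graph
  Hasse = record
    { size       = vertices
    ; adj        = λ x y → covers (decode x) (decode y) ∨ covers (decode y) (decode x)
    ; adj-sym    = λ x y → ∨-comm (covers (decode x) (decode y)) _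
    ; adj-irrefl = λ x → cong₂ _∨_ (covers-irrefl (decode x)) (covers-irrefl (decode x))
    }

  ℓ : ℕ
  ℓ = rank top

  rankᵛ : Vx Hasse → ℕ
  rankᵛ = rank ∘ decode

  rankᵛ-encode : ∀ u → rankᵛ (encode u) ≡ rank u
  rankᵛ-encode u = cong rank (decode-encode u)

  rankᵛ-adj : ∀ {x y} → adj Hasse x y ≡ true → rankᵛ y ≤ suc (rankᵛ x)
  rankᵛ-adj {x} {y} edge with ∨≡true⁻ {covers (decode x) (decode y)} edge
  ... | inj₁ x⋖y = ℕP.≤-reflexive (⋖-rank (covers⇒⋖ (decode x) (decode y) x⋖y))
  ... | inj₂ y⋖x = ℕP.≤-trans (ℕP.n≤1+n (rankᵛ y))
                     (ℕP.≤-trans (ℕP.≤-reflexive (sym (⋖-rank (covers⇒⋖ (decode y) (decode x) y⋖x)))) (ℕP.n≤1+n _))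

  rank≤ℓ : ∀ u → rank u ≤ ℓ
  rank≤ℓ bot = z≤n
  rank≤ℓ top = ℕP.≤-refl
  rank≤ℓ (bv _) = s≤s z≤n
  rank≤ℓ (gv _) = s≤s (s≤s z≤n)
  rank≤ℓ (av _) = s≤s (s≤s z≤n)
  rank≤ℓ (ev _ j) = s≤s (s≤s (s≤s (ℕP.<⇒≤ (FP.toℕ<n j))))
  rank≤ℓ (cv j) = s≤s (s≤s (s≤s (ℕP.<⇒≤ (FP.toℕ<n j))))

  ℓ≤size : ℓ ≤ size Hasse
  ℓ≤size = subst (ℓ ≤_) (sym vertices≡) (ℕP.+-monoʳ-≤ 2 (ℕP.≤-trans (ℕP.+-mono-≤ (s≤s z≤n) (ℕP.m≤n+m s (m * s)))
                             (ℕP.≤-trans (ℕP.m≤n+m _ cells) (ℕP.m≤n+m _ cells))))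

  rankᵛ≤size : ∀ x → rankᵛ x ≤ size Hasse
  rankᵛ≤size x = ℕP.≤-trans (rank≤ℓ (decode x)) ℓ≤size

  open Graded Hasse rankᵛ (λ {x} {y} → rankᵛ-adj {x} {y}) rankᵛ≤size public
  open Walks Hasse public

  ⋖⇒rises : ∀ {u v} → u ⋖ v → Rises (encode u) (encode v)
  ⋖⇒rises {u} {v} u⋖v = rises 1 (s≤s z≤n) (reach-adj {encode u} {encode v} edge) rank-up
    where
    edge : adj Hasse (encode u) (encode v) ≡ true
    edge rewrite decode-encode u | decode-encode v | ⋖⇒covers u⋖v = refl
    rank-up : rankᵛ (encode v) ≡ rankᵛ (encode u) + 1
    rank-up = begin
      rankᵛ (encode v)      ≡⟨ rankᵛ-encode v ⟩
      rank v                ≡⟨ ⋖-rank u⋖v ⟩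
      suc (rank u)          ≡⟨ ℕP.+-comm 1 (rank u) ⟩
      rank u + 1            ≡⟨ cong (_+ 1) (rankᵛ-encode u) ⟨
      rankᵛ (encode u) + 1  ∎
      where open ≡-Reasoning

  rises⇒≼ : ∀ {x y} → Rises x y → decode x ≼ decode y
  rises⇒≼ {x} {y} ρ = geodesic-induction {x} {gap ρ} {y} (λ v → decode x ≼ decode v) (≼-refl _) (λ {u} {v} → step {u} {v}) (walk ρ) (rank-gap ρ)
    where
    step : ∀ {u v} → decode x ≼ decode u → adj Hasse u v ≡ true → rankᵛ v ≡ suc (rankᵛ u) →
           decode x ≼ decode v
    step {u} {v} x≼u edge up with ∨≡true⁻ {covers (decode u) (decode v)} edge
    ... | inj₁ u⋖v = ≼-⋖-trans x≼u (covers⇒⋖ (decode u) (decode v) u⋖v)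
    ... | inj₂ v⋖u = ⊥-elim (ℕP.<-irrefl refl (ℕP.≤-trans (ℕP.n≤1+n _) (ℕP.≤-reflexive (sym twoUp))))
      where
      twoUp : rankᵛ u ≡ suc (suc (rankᵛ u))
      twoUp = trans (⋖-rank (covers⇒⋖ (decode v) (decode u) v⋖u)) (cong suc up)

  chain-rises : (f : Fin s → El) → (∀ j → f (inject₁ j) ⋖ f (fsuc j)) → f (fromℕ S) ⋖ top →
    ∀ j → Rises (encode (f j)) (encode top)
  chain-rises f step final =
    >-weakInduction (λ j → Rises (encode (f j)) (encode top)) (⋖⇒rises final)
                    (λ j rest → rises-trans (⋖⇒rises (step j)) rest)

  ascent⇒isPath : ∀ {k L} {v : Vec (Vx Hasse) (suc k)} → Ascent v L →
    V.head v ≡ encode bot → V.last v ≡ encode top → isPath Hasse ℓ v ≡ true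
  ascent⇒isPath {L = L} {v} a head≡bot last≡top = isPath⁺ v (subst (λ n → pathLen Hasse v ≡ just n) L≡ℓ (ascent-pathLen a))
    where
    L≡ℓ : L ≡ ℓ
    L≡ℓ = begin
      L                           ≡⟨ cong (_+ L) (rankᵛ-encode bot) ⟨
      rankᵛ (encode bot) + L      ≡⟨ cong (λ x → rankᵛ x + L) head≡bot ⟨
      rankᵛ (V.head v) + L        ≡⟨ ascent-rank a ⟨
      rankᵛ (V.last v)            ≡⟨ cong rankᵛ last≡top ⟩
      rankᵛ (encode top)          ≡⟨ rankᵛ-encode top ⟩
      ℓ                           ∎
      where open ≡-Reasoning

module TorsionCycle (Q M S : ℕ) where

  open import Data.Integer using (-_; _+_; _-_; _*_)
  open FiniteSums
  open FormalChains
  open HasseDiagram Q M S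

  N : ℕ
  N = size Hasse

  via : El → El → Tuple N 4
  via u v = encode bot ∷ encode u ∷ encode v ∷ encode top ∷ []

  via₃ : El → El → El → Tuple N 5
  via₃ u v w = encode bot ∷ encode u ∷ encode v ∷ encode w ∷ encode top ∷ []

  e₀ : Fin m → El
  e₀ i = ev i fzero

  c₀ : El
  c₀ = cv fzero

  cycleTerm : Fin m → LinComb N 4
  cycleTerm i = (1ℤ , via (av i) (e₀ i)) ∷ (-1ℤ , via (av (sucMod i)) (e₀ i)) ∷ []

  z : Coeff Hasse 3
  z y = ∑[ i < m ] ⟦ cycleTerm i ⟧ₗ y

  fillTerm : Cell → LinComb N 5
  fillTerm r@(k , i) =
      ( 1ℤ , via₃ (bv r) (gv r) (e₀ i))
    ∷ (-1ℤ , via₃ (bv r) (av i) (e₀ i))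
    ∷ (-1ℤ , via₃ (bv (sucLex r)) (gv r) (e₀ i))
    ∷ ( 1ℤ , via₃ (bv (sucLex r)) (av (sucMod i)) (e₀ i))
    ∷ (-1ℤ , via₃ (bv r) (gv r) c₀)
    ∷ ( 1ℤ , via₃ (bv (sucLex r)) (gv r) c₀)
    ∷ []

  W : Coeff Hasse 4
  W x = ∑² (λ r → ⟦ fillTerm r ⟧ₗ x)

  e₀-rises : ∀ i → Rises (encode (e₀ i)) (encode top)
  e₀-rises i = chain-rises (ev i) (λ j → e⋖e i (inject₁ j) (fsuc j) (cong suc (sym (FP.toℕ-inject₁ j)))) (e⋖top i) fzero

  c₀-rises : Rises (encode c₀) (encode top)
  c₀-rises = chain-rises cv (λ j → c⋖c (inject₁ j) (fsuc j) (cong suc (sym (FP.toℕ-inject₁ j)))) c⋖top fzero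

  bot-rises-a : ∀ i → Rises (encode bot) (encode (av i))
  bot-rises-a i = rises-trans (⋖⇒rises (bot⋖b (fzero , i))) (⋖⇒rises (b⋖a fzero i))

  isPath-via : ∀ {u v} → Rises (encode bot) (encode u) → u ⋖ v → Rises (encode v) (encode top) →
    isPath Hasse ℓ (via u v) ≡ true
  isPath-via ρ₁ u⋖v ρ₃ = ascent⇒isPath (ρ₁ ∷ ⋖⇒rises u⋖v ∷ ρ₃ ∷ [ _ ]) refl refl

  isPath-via₃ : ∀ {u v w} → bot ⋖ u → u ⋖ v → v ⋖ w → Rises (encode w) (encode top) →
    isPath Hasse ℓ (via₃ u v w) ≡ true
  isPath-via₃ bot⋖u u⋖v v⋖w ρ =
    ascent⇒isPath (⋖⇒rises bot⋖u ∷ ⋖⇒rises u⋖v ∷ ⋖⇒rises v⋖w ∷ ρ ∷ [ _ ]) refl refl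

  cycleTerm-paths : ∀ i → SupportedOnPaths Hasse ℓ (cycleTerm i)
  cycleTerm-paths i = isPath-via (bot-rises-a i) (a⋖e i) (e₀-rises i)
                    ∷ isPath-via (bot-rises-a (sucMod i)) (a⋖e′ i) (e₀-rises i)
                    ∷ []

  fillTerm-paths : ∀ r → SupportedOnPaths Hasse ℓ (fillTerm r)
  fillTerm-paths r@(k , i) =
      isPath-via₃ (bot⋖b r) (b⋖g r) (g⋖e k i) (e₀-rises i)
    ∷ isPath-via₃ (bot⋖b r) (b⋖a k i) (a⋖e i) (e₀-rises i)
    ∷ isPath-via₃ (bot⋖b (sucLex r)) (b⋖g′ r) (g⋖e k i) (e₀-rises i)
    ∷ isPath-via₃ (bot⋖b (sucLex r)) (b⋖a _ (sucMod i)) (a⋖e′ i) (e₀-rises i)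
    ∷ isPath-via₃ (bot⋖b r) (b⋖g r) (g⋖c r) c₀-rises
    ∷ isPath-via₃ (bot⋖b (sucLex r)) (b⋖g′ r) (g⋖c r) c₀-rises
    ∷ []

  z-offPath : ∀ y → isPath Hasse ℓ y ≡ false → z y ≡ 0ℤ
  z-offPath y y-nonpath = ∑-zero (λ i → ⟦ cycleTerm i ⟧ₗ y)
    (λ i → ⟦⟧ₗ-offPath Hasse ℓ {L = cycleTerm i} {y} (cycleTerm-paths i) y-nonpath)

  W-offPath : ∀ x → isPath Hasse ℓ x ≡ false → W x ≡ 0ℤ
  W-offPath x x-nonpath = ∑-zero (λ k → ∑[ i < m ] ⟦ fillTerm (k , i) ⟧ₗ x) (λ k → ∑-zero (λ i → ⟦ fillTerm (k , i) ⟧ₗ x)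
    (λ i → ⟦⟧ₗ-offPath Hasse ℓ {L = fillTerm (k , i)} {x} (fillTerm-paths (k , i)) x-nonpath))

  module _ (y : Tuple N 4) where

    ⟨_,_⟩ : El → El → ℤ
    ⟨ u , v ⟩ = ⟦ via u v ⟧ y

    z≡∑differences : z y ≡ ∑[ i < m ] (⟨ av i , e₀ i ⟩ - ⟨ av (sucMod i) , e₀ i ⟩)
    z≡∑differences = sum-cong-≗ (λ i → normalise ⟨ av i , e₀ i ⟩ ⟨ av (sucMod i) , e₀ i ⟩)
      where
      normalise : ∀ a b → 1ℤ * a + (-1ℤ * b + 0ℤ) ≡ a - b
      normalise = solve-∀

    rawBoundary-fillTerm : ∀ r → rawBoundary ⟦ fillTerm r ⟧ₗ y ≡
        (⟨ av (proj₂ r) , e₀ (proj₂ r) ⟩ - ⟨ av (sucMod (proj₂ r)) , e₀ (proj₂ r) ⟩)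
      + ((⟨ bv r , av (proj₂ r) ⟩ - ⟨ bv (sucLex r) , av (sucMod (proj₂ r)) ⟩)
      + ((- ⟨ bv r , c₀ ⟩) - (- ⟨ bv (sucLex r) , c₀ ⟩)))
    rawBoundary-fillTerm r@(k , i) =
      trans (rawBoundary-⟦⟧ₗ (fillTerm r) y)
            (faces ⟨ gv r , e₀ i ⟩ ⟨ av i , e₀ i ⟩ ⟨ av (sucMod i) , e₀ i ⟩ ⟨ gv r , c₀ ⟩
                   ⟨ bv r , e₀ i ⟩ ⟨ bv (sucLex r) , e₀ i ⟩ ⟨ bv r , c₀ ⟩ ⟨ bv (sucLex r) , c₀ ⟩
                   ⟨ bv r , gv r ⟩ ⟨ bv r , av i ⟩ ⟨ bv (sucLex r) , gv r ⟩ ⟨ bv (sucLex r) , av (sucMod i) ⟩)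
      where
      faces : ∀ ge ae a′e gc be b′e bc b′c bg ba b′g b′a′ →
          - 1ℤ * (1ℤ * ge + (-1ℤ * ae + (-1ℤ * ge + (1ℤ * a′e + (-1ℤ * gc + (1ℤ * gc + 0ℤ))))))
        + (- (- 1ℤ) * (1ℤ * be + (-1ℤ * be + (-1ℤ * b′e + (1ℤ * b′e + (-1ℤ * bc + (1ℤ * b′c + 0ℤ))))))
        + (- (- (- 1ℤ)) * (1ℤ * bg + (-1ℤ * ba + (-1ℤ * b′g + (1ℤ * b′a′ + (-1ℤ * bg + (1ℤ * b′g + 0ℤ))))))
        + 0ℤ))
        ≡ (ae - a′e) + ((ba - b′a′) + ((- bc) - (- b′c)))
      faces = solve-∀

    rawBoundary-W : rawBoundary W y ≡ + q * z y
    rawBoundary-W = begin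
      rawBoundary W y
        ≡⟨ rawBoundary-∑ (λ k x → ∑[ i < m ] ⟦ fillTerm (k , i) ⟧ₗ x) y ⟩
      ∑[ k < q ] rawBoundary (λ x → ∑[ i < m ] ⟦ fillTerm (k , i) ⟧ₗ x) y
        ≡⟨ sum-cong-≗ (λ k → rawBoundary-∑ (λ i → ⟦ fillTerm (k , i) ⟧ₗ) y) ⟩
      ∑² (λ r → rawBoundary ⟦ fillTerm r ⟧ₗ y)
        ≡⟨ sum-cong-≗ (λ k → sum-cong-≗ (λ i → rawBoundary-fillTerm (k , i))) ⟩
      ∑² (λ r → cycleDiff′ r + (Pa r - Pa (sucLex r) + (Pc r - Pc (sucLex r))))
        ≡⟨ ∑²-distrib-+ cycleDiff′ (λ r → Pa r - Pa (sucLex r) + (Pc r - Pc (sucLex r))) ⟩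
      ∑² cycleDiff′ + ∑² (λ r → Pa r - Pa (sucLex r) + (Pc r - Pc (sucLex r)))
        ≡⟨ cong (_+_ (∑² cycleDiff′)) (∑²-distrib-+ (λ r → Pa r - Pa (sucLex r)) (λ r → Pc r - Pc (sucLex r))) ⟩
      ∑² cycleDiff′ + (∑² (λ r → Pa r - Pa (sucLex r)) + ∑² (λ r → Pc r - Pc (sucLex r)))
        ≡⟨ cong (_+_ (∑² cycleDiff′)) (cong₂ _+_ (∑²-sucLex-telescope Pa) (∑²-sucLex-telescope Pc)) ⟩
      ∑² cycleDiff′ + 0ℤ
        ≡⟨ ℤP.+-identityʳ (∑² cycleDiff′) ⟩
      ∑[ k < q ] sum cycleDiff
        ≡⟨ ∑-const q (sum cycleDiff) ⟩
      + q * sum cycleDiff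
        ≡⟨ cong (+ q *_) z≡∑differences ⟨
      + q * z y ∎
      where
      open ≡-Reasoning
      cycleDiff : Fin m → ℤ
      cycleDiff i = ⟨ av i , e₀ i ⟩ - ⟨ av (sucMod i) , e₀ i ⟩
      cycleDiff′ : Cell → ℤ
      cycleDiff′ r = cycleDiff (proj₂ r)
      Pa Pc : Cell → ℤ
      Pa r = ⟨ bv r , av (proj₂ r) ⟩
      Pc r = - ⟨ bv r , c₀ ⟩

  rawBoundary-z : ∀ y → rawBoundary z y ≡ 0ℤ
  rawBoundary-z y = begin
    rawBoundary z y                                  ≡⟨ rawBoundary-∑ (λ i → ⟦ cycleTerm i ⟧ₗ) y ⟩
    ∑[ i < m ] rawBoundary ⟦ cycleTerm i ⟧ₗ y         ≡⟨ sum-cong-≗ (λ i → trans (rawBoundary-⟦⟧ₗ (cycleTerm i) y)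
                                                                             (faces (⟨ e₀ i ⟩) (⟨ av i ⟩) (⟨ av (sucMod i) ⟩))) ⟩
    ∑[ i < m ] (⟨ av i ⟩ - ⟨ av (sucMod i) ⟩)        ≡⟨ ∑-sucMod-telescope (λ i → ⟨ av i ⟩) ⟩
    0ℤ                                               ∎
    where
    open ≡-Reasoning
    ⟨_⟩ : El → ℤ
    ⟨ u ⟩ = ⟦ encode bot ∷ encode u ∷ encode top ∷ [] ⟧ y
    faces : ∀ e a a′ → - 1ℤ * (1ℤ * e + (-1ℤ * e + 0ℤ)) + (- (- 1ℤ) * (1ℤ * a + (-1ℤ * a′ + 0ℤ)) + 0ℤ) ≡ a - a′
    faces = solve-∀

module Cocycle (Q M′ S : ℕ) (q∣M : suc Q ℕ∣.∣ suc M′) where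

  open import Data.Integer using (-_; _+_; _-_; _*_)
  open FiniteSums
  open FormalChains
  open HasseDiagram Q (suc M′) S
  open TorsionCycle Q (suc M′) S

  ι : Cell → ℤ
  ι (k , i) = + toℕ k + + toℕ i

  φ : El → El → ℤ
  φ (bv (k , i)) (gv (k′ , i′)) = 𝟙 ((i′ == i) ∧ (k′ == k))
  φ (bv (_ , i)) (ev i′ _) = 𝟙 (i′ == i)
  φ (bv r) (cv _) = - ι r
  φ (av i) (ev i′ _) = 𝟙 (i′ == i)
  φ (gv r) (cv _) = - (ι r + 1ℤ)
  φ _ _ = 0ℤ

  M : ℕ
  M = suc M′

  q∣Mℤ : + q ∣ + M
  q∣Mℤ = ∣ᵤ⇒∣ q∣M

  private
    ∣0 : ∀ {x} → x ≡ 0ℤ → + q ∣ x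
    ∣0 {x} x≡0 = divides 0ℤ (trans x≡0 (sym (ℤP.*-zeroˡ (+ q))))
    cancel : ∀ a → a - a + 0ℤ ≡ 0ℤ
    cancel = solve-∀
    cancel′ : ∀ a → 0ℤ - a + a ≡ 0ℤ
    cancel′ = solve-∀

  -- Along the cycle of cells ι increases by one, except at the wrap-arounds, where it changes by
  -- 1 − M or 1 − (M + q); both are ≡ 1 (mod q) because q ∣ M.
  ι-sucLex : ∀ r → + q ∣ (ι (sucLex r) - ι r - 1ℤ)
  ι-sucLex (k , i) with lastView i
  ... | inner i′ rewrite ==-≢ (FP.fromℕ≢inject₁ {i = i′} ∘ sym) | sucMod-inject₁ i′ | FP.toℕ-inject₁ i′ =
    ∣0 (step (+ toℕ k) (+ toℕ i′))
    where
    step : ∀ a b → a + (1ℤ + b) - (a + b) - 1ℤ ≡ 0ℤ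
    step = solve-∀
  ... | last rewrite ==-refl (fromℕ M) | sucMod-fromℕ M | FP.toℕ-fromℕ M with lastView k
  ...   | inner k′ rewrite sucMod-inject₁ k′ | FP.toℕ-inject₁ k′ =
    subst (+ q ∣_) (sym (step (+ toℕ k′) (+ M))) (∣m⇒∣-m q∣Mℤ)
    where
    step : ∀ a b → (1ℤ + a) + 0ℤ - (a + b) - 1ℤ ≡ - b
    step = solve-∀
  ...   | last rewrite sucMod-fromℕ Q | FP.toℕ-fromℕ Q =
    subst (+ q ∣_) (sym (step (+ Q) (+ M))) (∣m⇒∣-m (∣m∣n⇒∣m+n q∣Mℤ (∣-refl {+ q})))
    where
    step : ∀ a b → 0ℤ + 0ℤ - (a + b) - 1ℤ ≡ - (b + (1ℤ + a))
    step = solve-∀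

  i≢sucMod-i : ∀ (i : Fin m) → (i == sucMod i) ≡ false
  i≢sucMod-i i = ==-≢ (sucMod-≢ i ∘ sym)

  φ-cocycle : ∀ {u v w} → u ≼ v → v ≼ w → rank u < rank v → rank v < rank w →
    1 ≤ rank u → rank w < ℓ → + q ∣ (φ v w - φ u w + φ u v)
  φ-cocycle (≼-bot _) _ _ _ () _
  φ-cocycle (≼-top _) _ _ v<w _ w<ℓ = ⊥-elim (ℕP.<-asym v<w w<ℓ)
  φ-cocycle (≼-refl _) _ u<v _ _ _ = ⊥-elim (ℕP.<-irrefl refl u<v)
  φ-cocycle _ (≼-top _) _ _ _ w<ℓ = ⊥-elim (ℕP.<-irrefl refl w<ℓ)
  φ-cocycle _ (≼-refl _) _ v<w _ _ = ⊥-elim (ℕP.<-irrefl refl v<w)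
  φ-cocycle (b≼g (k , i)) (g≼e k i j) _ _ _ _ rewrite ==-refl i | ==-refl k = ∣0 refl
  φ-cocycle (b≼g (k , i)) (g≼c (k , i) j) _ _ _ _ rewrite ==-refl i | ==-refl k = ∣0 (cancel₁ (ι (k , i)))
    where
    cancel₁ : ∀ a → - (a + 1ℤ) - - a + 1ℤ ≡ 0ℤ
    cancel₁ = solve-∀
  φ-cocycle (b≼g′ (k , i)) (g≼e k i j) _ _ _ _ rewrite i≢sucMod-i i = ∣0 refl
  φ-cocycle (b≼g′ r) (g≼c r j) _ _ _ _ rewrite i≢sucMod-i (proj₂ r) =
    subst (+ q ∣_) (rearrange (ι (sucLex r)) (ι r)) (ι-sucLex r)
    where
    rearrange : ∀ b a → b - a - 1ℤ ≡ - (a + 1ℤ) - - b + 0ℤ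
    rearrange = solve-∀
  φ-cocycle (b≼a k i) (a≼e i j) _ _ _ _ = ∣0 (cancel (φ (av i) (ev i j)))
  φ-cocycle (b≼a k .(sucMod i)) (a≼e′ i j) _ _ _ _ = ∣0 (cancel (φ (av (sucMod i)) (ev i j)))
  φ-cocycle (b≼e k i j) (e≼e i j j′) _ _ _ _ = ∣0 (cancel′ (φ (bv (k , i)) (ev i j)))
  φ-cocycle (b≼e′ k i j) (e≼e i j j′) _ _ _ _ = ∣0 (cancel′ (φ (bv (k , sucMod i)) (ev i j)))
  φ-cocycle (b≼c r j) (c≼c j j′) _ _ _ _ = ∣0 (cancel′ (φ (bv r) (cv j)))
  φ-cocycle (g≼e k i j) (e≼e i j j′) _ _ _ _ = ∣0 refl
  φ-cocycle (g≼c r j) (c≼c j j′) _ _ _ _ = ∣0 (cancel′ (φ (gv r) (cv j)))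
  φ-cocycle (a≼e i j) (e≼e i j j′) _ _ _ _ = ∣0 (cancel′ (φ (av i) (ev i j)))
  φ-cocycle (a≼e′ i j) (e≼e i j j′) _ _ _ _ = ∣0 (cancel′ (φ (av (sucMod i)) (ev i j)))
  φ-cocycle (e≼e i j j′) (e≼e i j′ j″) _ _ _ _ = ∣0 refl
  φ-cocycle (c≼c j j′) (c≼c j′ j″) _ _ _ _ = ∣0 refl

  ends : Vx Hasse → Vx Hasse → Bool
  ends x₀ x₃ = (x₀ == encode bot) ∧ (x₃ == encode top)

  w : Coeff Hasse 3
  w (x₀ ∷ x₁ ∷ x₂ ∷ x₃ ∷ []) = if ends x₀ x₃ then φ (decode x₁) (decode x₂) else 0ℤ

  w-off : ∀ x₀ x₁ x₂ x₃ → ends x₀ x₃ ≡ false → w (x₀ ∷ x₁ ∷ x₂ ∷ x₃ ∷ []) ≡ 0ℤ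
  w-off _ _ _ _ e rewrite e = refl

  w-on : ∀ x₀ x₁ x₂ x₃ → ends x₀ x₃ ≡ true → w (x₀ ∷ x₁ ∷ x₂ ∷ x₃ ∷ []) ≡ φ (decode x₁) (decode x₂)
  w-on _ _ _ _ e rewrite e = refl

  ends⁻ : ∀ x₀ x₄ → ends x₀ x₄ ≡ true → x₀ ≡ encode bot × x₄ ≡ encode top
  ends⁻ x₀ x₄ e = ==⇒≡ (proj₁ (∧≡true⁻ {x₀ == encode bot} e)) , ==⇒≡ (proj₂ (∧≡true⁻ {x₀ == encode bot} e))

  δw-offEnds : ∀ x₀ x₁ x₂ x₃ x₄ → ends x₀ x₄ ≡ false → δ Hasse ℓ w (x₀ ∷ x₁ ∷ x₂ ∷ x₃ ∷ x₄ ∷ []) ≡ 0ℤ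
  δw-offEnds x₀ x₁ x₂ x₃ x₄ e = δ-vanishes Hasse ℓ w (x₀ ∷ x₁ ∷ x₂ ∷ x₃ ∷ x₄ ∷ []) λ
    { fzero → restrict-zero Hasse ℓ w {x₀ ∷ x₂ ∷ x₃ ∷ x₄ ∷ []} (w-off x₀ x₂ x₃ x₄ e)
    ; (fsuc fzero) → restrict-zero Hasse ℓ w {x₀ ∷ x₁ ∷ x₃ ∷ x₄ ∷ []} (w-off x₀ x₁ x₃ x₄ e)
    ; (fsuc (fsuc fzero)) → restrict-zero Hasse ℓ w {x₀ ∷ x₁ ∷ x₂ ∷ x₄ ∷ []} (w-off x₀ x₁ x₂ x₄ e) }

  δw-ascent : ∀ {x₀ x₁ x₂ x₃ x₄ L} → ends x₀ x₄ ≡ true → Ascent (x₀ ∷ x₁ ∷ x₂ ∷ x₃ ∷ x₄ ∷ []) L →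
    let φ₁₂ = φ (decode x₁) (decode x₂) ; φ₁₃ = φ (decode x₁) (decode x₃) ; φ₂₃ = φ (decode x₂) (decode x₃)
    in δ Hasse ℓ w (x₀ ∷ x₁ ∷ x₂ ∷ x₃ ∷ x₄ ∷ []) ≡ - (φ₂₃ - φ₁₃ + φ₁₂)
  δw-ascent {x₀} {x₁} {x₂} {x₃} {x₄} e asc = begin
    δ Hasse ℓ w (x₀ ∷ x₁ ∷ x₂ ∷ x₃ ∷ x₄ ∷ [])
      ≡⟨ sum-cong-≗ (λ i → cong (faceSign i *_) (onFace i)) ⟩
    - 1ℤ * w (x₀ ∷ x₂ ∷ x₃ ∷ x₄ ∷ []) + (1ℤ * w (x₀ ∷ x₁ ∷ x₃ ∷ x₄ ∷ []) + (- 1ℤ * w (x₀ ∷ x₁ ∷ x₂ ∷ x₄ ∷ []) + 0ℤ))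
      ≡⟨ cong₂ (λ a b → - 1ℤ * a + (1ℤ * b + (- 1ℤ * w (x₀ ∷ x₁ ∷ x₂ ∷ x₄ ∷ []) + 0ℤ)))
               (w-on x₀ x₂ x₃ x₄ e) (w-on x₀ x₁ x₃ x₄ e) ⟩
    - 1ℤ * φ₂₃ + (1ℤ * φ₁₃ + (- 1ℤ * w (x₀ ∷ x₁ ∷ x₂ ∷ x₄ ∷ []) + 0ℤ))
      ≡⟨ cong (λ c → - 1ℤ * φ₂₃ + (1ℤ * φ₁₃ + (- 1ℤ * c + 0ℤ))) (w-on x₀ x₁ x₂ x₄ e) ⟩
    - 1ℤ * φ₂₃ + (1ℤ * φ₁₃ + (- 1ℤ * φ₁₂ + 0ℤ))
      ≡⟨ collect φ₂₃ φ₁₃ φ₁₂ ⟩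
    - (φ₂₃ - φ₁₃ + φ₁₂) ∎
    where
    open ≡-Reasoning
    φ₁₂ φ₁₃ φ₂₃ : ℤ
    φ₁₂ = φ (decode x₁) (decode x₂)
    φ₁₃ = φ (decode x₁) (decode x₃)
    φ₂₃ = φ (decode x₂) (decode x₃)
    x = x₀ ∷ x₁ ∷ x₂ ∷ x₃ ∷ x₄ ∷ []
    bot-end = proj₁ (ends⁻ x₀ x₄ e)
    top-end = proj₂ (ends⁻ x₀ x₄ e)
    facePath : ∀ i → isPath Hasse ℓ (removeAt x (innerPos i)) ≡ true
    facePath fzero = ascent⇒isPath (ascent-removeInner asc fzero) bot-end top-end
    facePath (fsuc fzero) = ascent⇒isPath (ascent-removeInner asc (fsuc fzero)) bot-end top-end
    facePath (fsuc (fsuc fzero)) = ascent⇒isPath (ascent-removeInner asc (fsuc (fsuc fzero))) bot-end top-end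
    onFace : ∀ i → restrictToPaths Hasse ℓ w (removeAt x (innerPos i)) ≡ w (removeAt x (innerPos i))
    onFace i = restrict-onPath Hasse ℓ w {removeAt x (innerPos i)} (facePath i)
    collect : ∀ a b c → - 1ℤ * a + (1ℤ * b + (- 1ℤ * c + 0ℤ)) ≡ - (a - b + c)
    collect = solve-∀

  δw-divisible : ∀ x → isPath Hasse ℓ x ≡ true → + q ∣ δ Hasse ℓ w x
  δw-divisible x@(x₀ ∷ x₁ ∷ x₂ ∷ x₃ ∷ x₄ ∷ []) x-path = byEnds (ends x₀ x₄) refl
    where
    byEnds : ∀ b → ends x₀ x₄ ≡ b → + q ∣ δ Hasse ℓ w x
    byEnds false e = ∣0 (δw-offEnds x₀ x₁ x₂ x₃ x₄ e)
    byEnds true e with ends⁻ x₀ x₄ e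
    ... | x₀≡bot , x₄≡top = onAscent (tight⇒ascent x (isPath⁻ x x-path) tight)
      where
      rank-x₀ : rankᵛ x₀ ≡ 0
      rank-x₀ = trans (cong rankᵛ x₀≡bot) (rankᵛ-encode bot)
      rank-x₄ : rankᵛ x₄ ≡ ℓ
      rank-x₄ = trans (cong rankᵛ x₄≡top) (rankᵛ-encode top)
      tight : rankᵛ x₄ ≡ rankᵛ x₀ ℕ.+ ℓ
      tight = trans rank-x₄ (cong (ℕ._+ ℓ) (sym rank-x₀))
      onAscent : ∀ {L} → Ascent x L → + q ∣ δ Hasse ℓ w x
      onAscent asc@(ρ₀ ∷ ρ₁ ∷ ρ₂ ∷ ρ₃ ∷ [ _ ]) =
        subst (+ q ∣_) (sym (δw-ascent e asc))
          (∣m⇒∣-m (φ-cocycle (rises⇒≼ ρ₁) (rises⇒≼ ρ₂) (rises-rank< ρ₁) (rises-rank< ρ₂)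
                             (subst (_< rankᵛ x₁) rank-x₀ (rises-rank< ρ₀))
                             (subst (rankᵛ x₃ <_) rank-x₄ (rises-rank< ρ₃))))

  Φ : Coeff Hasse 3 → ℤ
  Φ c = sumTuples 4 (λ y → w y * c y)

  Φ-boundary : (e : MC Hasse 4 ℓ) → + q ∣ Φ (∂ Hasse ℓ (proj₁ e))
  Φ-boundary (e , e-offPath) =
    subst (+ q ∣_) (sym (∂-δ-adjoint Hasse ℓ w e)) (∣-sumTuples 5 (λ x → e x * δ Hasse ℓ w x) term)
    where
    term : ∀ x → + q ∣ e x * δ Hasse ℓ w x
    term x with isPath Hasse ℓ x in x-path
    ... | true = ∣n⇒∣m*n (e x) (δw-divisible x x-path)
    ... | false = ∣0 (trans (cong (_* δ Hasse ℓ w x) (e-offPath x x-path)) (ℤP.*-zeroˡ (δ Hasse ℓ w x)))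

  ends-bot-top : ends (encode bot) (encode top) ≡ true
  ends-bot-top rewrite ==-refl (encode bot) | ==-refl (encode top) = refl

  w-via : ∀ u v → w (via u v) ≡ φ u v
  w-via u v = trans (w-on (encode bot) (encode u) (encode v) (encode top) ends-bot-top) (cong₂ φ (decode-encode u) (decode-encode v))

  Φ-z : Φ z ≡ + m
  Φ-z = begin
    sumTuples 4 (λ y → w y * ∑[ i < m ] ⟦ cycleTerm i ⟧ₗ y)
      ≡⟨ sumTuples-cong 4 (λ y → *-distribˡ-sum (w y) (λ i → ⟦ cycleTerm i ⟧ₗ y)) ⟩
    sumTuples 4 (λ y → ∑[ i < m ] (w y * ⟦ cycleTerm i ⟧ₗ y))
      ≡⟨ sumTuples-comm-∑ 4 (λ y i → w y * ⟦ cycleTerm i ⟧ₗ y) ⟩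
    ∑[ i < m ] sumTuples 4 (λ y → w y * ⟦ cycleTerm i ⟧ₗ y)
      ≡⟨ sum-cong-≗ (λ i → sumTuples-*⟦⟧ₗ 4 w (cycleTerm i)) ⟩
    ∑[ i < m ] evalₗ w (cycleTerm i)
      ≡⟨ sum-cong-≗ evalₗ-cycleTerm ⟩
    ∑[ i < m ] 1ℤ
      ≡⟨ ∑-const m 1ℤ ⟩
    + m * 1ℤ
      ≡⟨ ℤP.*-identityʳ (+ m) ⟩
    + m ∎
    where
    open ≡-Reasoning
    evalₗ-cycleTerm : ∀ i → evalₗ w (cycleTerm i) ≡ 1ℤ
    evalₗ-cycleTerm i rewrite w-via (av i) (e₀ i) | w-via (av (sucMod i)) (e₀ i) | ==-refl i | i≢sucMod-i i = refl

module CyclicSubgroup (Q M′ S : ℕ) (q∣M : suc Q ℕ∣.∣ suc M′) where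

  open import Data.Integer using (-_; _+_; _-_; _*_)
  open FormalChains
  open HasseDiagram Q (suc M′) S
  open TorsionCycle Q (suc M′) S
  open Cocycle Q M′ S q∣M

  cycle : ℤ → Cycle3 Hasse ℓ
  cycle a = (a·z , a·z-offPath) , ∂a·z≡0
    where
    a·z : Coeff Hasse 3
    a·z y = a * z y
    a·z-offPath : ∀ y → isPath Hasse ℓ y ≡ false → a·z y ≡ 0ℤ
    a·z-offPath y y-nonpath = trans (cong (a *_) (z-offPath y y-nonpath)) (ℤP.*-zeroʳ a)
    ∂a·z≡0 : ∀ y → ∂ Hasse ℓ a·z y ≡ 0ℤ
    ∂a·z≡0 y = ∂-cases Hasse ℓ a·z {y = y}
      (λ _ → trans (rawBoundary-* a z y) (trans (cong (a *_) (rawBoundary-z y)) (ℤP.*-zeroʳ a)))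
      (λ _ → refl)

  fillChain : ℤ → MC Hasse 4 ℓ
  fillChain k = (λ x → k * W x) , λ x x-nonpath → trans (cong (k *_) (W-offPath x x-nonpath)) (ℤP.*-zeroʳ k)

  ∂-fillChain : ∀ k y → ∂ Hasse ℓ (proj₁ (fillChain k)) y ≡ (k * + q) * z y
  ∂-fillChain k y = ∂-cases Hasse ℓ (λ x → k * W x) {y = y} onPath offPath
    where
    onPath : isPath Hasse ℓ y ≡ true → rawBoundary (λ x → k * W x) y ≡ (k * + q) * z y
    onPath _ = begin
      rawBoundary (λ x → k * W x) y ≡⟨ rawBoundary-* k W y ⟩
      k * rawBoundary W y           ≡⟨ cong (k *_) (rawBoundary-W y) ⟩
      k * (+ q * z y)               ≡⟨ ℤP.*-assoc k (+ q) (z y) ⟨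
      (k * + q) * z y               ∎
      where open ≡-Reasoning
    offPath : isPath Hasse ℓ y ≡ false → (k * + q) * z y ≡ 0ℤ
    offPath y-nonpath = trans (cong ((k * + q) *_) (z-offPath y y-nonpath)) (ℤP.*-zeroʳ (k * + q))

  cycle-cong : ∀ a b → + q ℤ∣ᵤ.∣ (a - b) → Homologous3 Hasse ℓ (cycle a) (cycle b)
  cycle-cong a b q∣a-b with ∣ᵤ⇒∣ {+ q} {a - b} q∣a-b
  ... | divides k a-b≡k*q = fillChain k , λ x →
    trans (factor a b (z x)) (trans (cong (λ d → d * z x) a-b≡k*q) (sym (∂-fillChain k x)))
    where
    factor : ∀ a b c → a * c - b * c ≡ (a - b) * c
    factor = solve-∀

  cycle-+ : ∀ a b → HomologousC Hasse ℓ (proj₁ (proj₁ (cycle (a + b)))) (cycle a +C cycle b)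
  cycle-+ a b = ((λ _ → 0ℤ) , λ _ _ → refl) , λ x → trans (cancel a b (z x)) (sym (∂-zero x))
    where
    cancel : ∀ a b c → (a + b) * c - (a * c + b * c) ≡ 0ℤ
    cancel = solve-∀
    ∂-zero : ∀ x → ∂ Hasse ℓ (λ _ → 0ℤ) x ≡ 0ℤ
    ∂-zero x = ∂-cases Hasse ℓ (λ _ → 0ℤ) {y = x} (λ _ → rawBoundary-0 x) (λ _ → refl)

  cycle-injective : ∀ a b → Homologous3 Hasse ℓ (cycle a) (cycle b) → + q ℤ∣ᵤ.∣ (a - b)
  cycle-injective a b (e , a·z-b·z≡∂e) = ∣⇒∣ᵤ (∣m+n∣n⇒∣m {m = a - b} q∣a-b+[a-b]M (∣n⇒∣m*n (a - b) q∣Mℤ))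
    where
    Φ-difference : Φ (λ y → a * z y - b * z y) ≡ (a - b) + (a - b) * + M
    Φ-difference = begin
      sumTuples 4 (λ y → w y * (a * z y - b * z y))  ≡⟨ sumTuples-cong 4 (λ y → factor (w y) a b (z y)) ⟩
      sumTuples 4 (λ y → (a - b) * (w y * z y))      ≡⟨ *-distribˡ-sumTuples 4 (a - b) (λ y → w y * z y) ⟨
      (a - b) * Φ z                                  ≡⟨ cong ((a - b) *_) Φ-z ⟩
      (a - b) * (1ℤ + + M)                            ≡⟨ ℤP.*-distribˡ-+ (a - b) 1ℤ (+ M) ⟩
      (a - b) * 1ℤ + (a - b) * + M                    ≡⟨ cong (_+ (a - b) * + M) (ℤP.*-identityʳ (a - b)) ⟩
      (a - b) + (a - b) * + M                         ∎
      where
      open ≡-Reasoning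
      factor : ∀ w a b c → w * (a * c - b * c) ≡ (a - b) * (w * c)
      factor = solve-∀
    q∣a-b+[a-b]M : + q ∣ (a - b) + (a - b) * + M
    q∣a-b+[a-b]M = subst (+ q ∣_) (trans (sumTuples-cong 4 (λ y → cong (w y *_) (sym (a·z-b·z≡∂e y)))) Φ-difference)
                         (Φ-boundary e)

  hasCyclicSubgroup : HasCyclicSubgroup3 Hasse ℓ q
  hasCyclicSubgroup = cycle , cycle-cong , cycle-+ , cycle-injective

open import Data.Nat using (_+_; _*_; _^_)

hasseFamily : ℕ → ℕ → ℕ → Graph
hasseFamily Q S t = HasseDiagram.Hasse Q (suc (t + Q * suc t)) S

size-hasseFamily : ∀ Q S t → let q = suc Q ; s = suc S in
  size (hasseFamily Q S t) ≡ (2 + s + (1 + q) * (s + (2 * q + 1))) + t * (q * (s + (2 * q + 1)))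
size-hasseFamily Q S t = trans (HasseDiagram.vertices≡ Q (suc (t + Q * suc t)) S) (count Q S t)
  where
  count : ∀ Q S t → let q = suc Q ; m = suc (suc (t + Q * suc t)) ; s = suc S in
    2 + (q * m + (q * m + (m + (m * s + s)))) ≡ (2 + s + (1 + q) * (s + (2 * q + 1))) + t * (q * (s + (2 * q + 1)))
  count = ℕ-Solver.solve-∀

hasseFamily-size-injective : ∀ Q S {i j} → size (hasseFamily Q S i) ≡ size (hasseFamily Q S j) → i ≡ j
hasseFamily-size-injective Q S {i} {j} eq =
  ℕP.*-cancelʳ-≡ i j _ (ℕP.+-cancelˡ-≡ _ _ _ (trans (sym (size-hasseFamily Q S i)) (trans eq (size-hasseFamily Q S j))))

theorem3p13 : (p n m : ℕ) → Prime p → 1 ≤ n → 1 ≤ m →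
    Σ (ℕ → Graph) λ Gs →
      (∀ i j → i ≢ j → ¬ (Gs i ≅G Gs j))
      × (∀ i → HasCyclicSubgroup3 (Gs i) (2 * n + 3) (p ^ m))
theorem3p13 p zero m _ () _
theorem3p13 p (suc n) m p-prime _ _ = hasseFamily Q S , non-isomorphic , torsion
  where
  instance
    p≢0 : ℕ.NonZero p
    p≢0 = prime⇒nonZero p-prime
  Q S : ℕ
  Q = ℕ.pred (p ^ m)
  S = ℕ.pred (2 * suc n)
  non-isomorphic : ∀ i j → i ≢ j → ¬ (hasseFamily Q S i ≅G hasseFamily Q S j)
  non-isomorphic i j i≢j (φ , _) = i≢j (hasseFamily-size-injective Q S (↔⇒≡ φ))
  torsion : ∀ i → HasCyclicSubgroup3 (hasseFamily Q S i) (2 * suc n + 3) (p ^ m)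
  torsion i = subst₂ (HasCyclicSubgroup3 (hasseFamily Q S i)) (ℕP.+-comm 3 (2 * suc n)) (ℕP.suc-pred (p ^ m) {{ℕP.m^n≢0 p m}})
    (CyclicSubgroup.hasCyclicSubgroup Q (i + Q * suc i) S (ℕ∣.m∣m*n (suc i)))
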